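{- For every positive integer $n$, the number $P(n,2)$ of two-ball prime juggling patterns of period $n$ satisfies \[ P(n,2)=\sum_{t\ge 1}\bigg(\sum_{\substack{p_1>\cdots>p_t \ge 1 \\ p_1+\cdots+p_t=n}}\frac{1}{t(t+1)}\prod_{i=1}^t\bigg(\frac{i+1}{i}\bigg)^{p_i}\bigg), \] where the inner sum is over strictly decreasing sequences of positive integers $p_1>\cdots>p_t$ summing to $n$ (i.e. partitions of $n$ into $t$ distinct parts).
   Context: For an integer $b\ge 1$, the state graph for $b$ balls is the infinite directed graph whose vertices (states) are the infinite $0$-$1$ sequences $\mathbf{c}=\langle c_1,c_2,\ldots\rangle$ (indexed by positive integers) containing exactly $b$ entries equal to $1$, with a directed edge $\mathbf{c}\to\mathbf{d}$ if and only if $d_i\ge c_{i+1}$ for all $i\ge 1$ (loops allowed). A prime juggling pattern of period $n$ with $b$ balls is a directed cycle of length $n$ in this graph, i.e. a closed walk $v_0\to v_1\to\cdots\to v_n=v_0$ with $v_0,\ldots,v_{n-1}$ pairwise distinct, where closed walks differing only by a cyclic shift of the starting point are identified (so a loop is a cycle of length $1$). $P(n,b)$ denotes the number of such cycles of length $n$. -}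

module Defs where

open import Data.Nat using (ℕ; zero; suc; _+_; _*_; _≤_; _<_; _≟_)
open import Data.Nat.ListAction using (sum)
open import Data.Bool using (Bool; true; false; _∧_; _∨_; not; T)
open import Data.Product using (Σ; _×_; _,_; ∃; ∃-syntax)
open import Data.List using (List; []; _∷_; map; length; downFrom; filter; _++_)
open import Data.Fin using (Fin)
open import Data.Integer using (+_)
open import Data.Rational using (ℚ; 0ℚ; 1ℚ; _/_)
import Data.Rational as Q
open import Relation.Binary.PropositionalEquality using (_≡_; _≢_)
open import Relation.Nullary using (¬_)

-- A state is an infinite 0-1 sequence c = ⟨c₁,c₂,…⟩ with exactly two
-- entries equal to 1.  Such a sequence is determined by the positions
-- 1 ≤ i < j of its two ones; we store these positions and recover the
-- sequence with `seq`.

record State : Set where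
  constructor st
  field
    i     : ℕ
    j     : ℕ
    1≤i   : 1 ≤ i
    i<j   : i < j

-- The 0-1 sequence of a state (indexed by positive integers k ≥ 1;
-- the value at index 0 is irrelevant and never used by the edge relation).
seq : State → ℕ → Bool
seq (st i j _ _) k = Data.Nat._≡ᵇ_ k i ∨ Data.Nat._≡ᵇ_ k j

-- Edge c → d iff d_k ≥ c_{k+1} for all k ≥ 1 (for 0-1 values:
-- c_{k+1} = 1 implies d_k = 1).
Edge : State → State → Set
Edge c d = ∀ k → 1 ≤ k → T (seq c (suc k)) → T (seq d k)

-- Closed walks of length n with pairwise distinct vertices
-- v₀ → v₁ → ⋯ → v_{n-1} → v_n = v₀, represented as n-periodic
-- functions ℕ → State.

record Cycle (n : ℕ) : Set where
  field
    v        : ℕ → State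
    periodic : ∀ k → v (k + n) ≡ v k
    edges    : ∀ k → Edge (v k) (v (suc k))
    distinct : ∀ a b → a < n → b < n → v a ≡ v b → a ≡ b

open Cycle public

_≈c_ : ∀ {n} → Cycle n → Cycle n → Set
_≈c_ C D = ∃[ r ] (∀ k → v D k ≡ v C (k + r))

-- "There are exactly m cycles of length n (up to cyclic shift)":
-- a family of m representatives, pairwise non-equivalent, such that
-- every closed walk is equivalent to one of them.
HasCycleCount : ℕ → ℕ → Set
HasCycleCount n m =
  Σ (Fin m → Cycle n) λ rep →
    (∀ a b → rep a ≈c rep b → a ≡ b) ×
    (∀ (C : Cycle n) → ∃[ a ] (C ≈c rep a))

sublists : {A : Set} → List A → List (List A)
sublists []       = [] ∷ []
sublists (x ∷ xs) = map (x ∷_) (sublists xs) ++ sublists xs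

-- strictly decreasing sequences p₁ > ⋯ > p_t ≥ 1 with sum n
-- = sublists of [n, n-1, …, 1] whose sum is n
distinctPartitions : ℕ → List (List ℕ)
distinctPartitions n =
  filter (λ p → sum p ≟ n) (sublists (map suc (downFrom n)))

_^ℚ_ : ℚ → ℕ → ℚ
q ^ℚ zero  = 1ℚ
q ^ℚ suc e = q Q.* (q ^ℚ e)

-- ∏_{i=s+1}^{s+t} ((i+1)/i)^{p_{i-s}}  (prodFrom s ps; called with s = 0)
prodFrom : ℕ → List ℕ → ℚ
prodFrom s []       = 1ℚ
prodFrom s (p ∷ ps) = (((+ (suc (suc s))) / suc s) ^ℚ p) Q.* prodFrom (suc s) ps

-- term for p = (p₁,…,p_t):  1/(t(t+1)) · ∏_{i=1}^t ((i+1)/i)^{p_i}.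
-- Only t ≥ 1 occurs (the sum is over t ≥ 1); the empty sequence gets 0.
term : List ℕ → ℚ
term []            = 0ℚ
term ps@(_ ∷ rest) =
  ((+ 1) / (suc (length rest) * suc (suc (length rest)))) Q.* prodFrom 0 ps

sumℚ : List ℚ → ℚ
sumℚ []       = 0ℚ
sumℚ (x ∷ xs) = x Q.+ sumℚ xs

RHS : ℕ → ℚ
RHS n = sumℚ (map term (distinctPartitions n))

-- A cycle of the two-ball state graph has a choice only at the states ready g = ⟨1, g + 2⟩: the
-- landing ball is thrown either above the other ball, which then lands after g + 1 beats and may
-- be followed by any ready state, or below it, to height c ≤ g, reaching ready (g ∸ c) after c
-- beats; every other state falls deterministically.  Rotating a cycle to start at its largest
-- ready value g₀ identifies cycles with lists of distinct ready values starting with g₀, each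
-- marked high or low, a low value being followed by a smaller one; the period is the sum of the
-- numbers of beats between consecutive ready states.
--
-- Such a list is built by inserting n ∸ 1, …, 0 in decreasing order: a value v is absent,
-- joins one of the i high entries (which turns low; the period is unchanged), or becomes a new
-- high entry after one of them (the period grows by v + 1 and i by one).  The choices made
-- with new entries at the values p₁ ∸ 1 > ⋯ > p_t ∸ 1 are counted by a product of powers of
-- 1, 2, …, t + 1, which equals the summand of p₁ > ⋯ > p_t; the period is p₁ + ⋯ + p_t.

module Submission where

open import Defs

open import Data.Bool using (Bool; true; false; not; T; if_then_else_)
open import Data.Bool.Properties using (T-∨; not-involutive)
open import Data.Empty using (⊥; ⊥-elim)
open import Data.Fin using (Fin; zero; suc; toℕ; fromℕ<)
open import Data.Fin.Properties using (toℕ-injective; toℕ<n; toℕ-fromℕ<; +↔⊎; *↔×)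
import Data.Integer as ℤ
import Data.Integer.Properties as ℤₚ
open import Data.List using (List; []; _∷_; _++_; length; map; applyUpTo; downFrom; filter)
open import Data.List.Membership.Propositional using (_∈_)
open import Data.List.Properties
  using (∷-injective; length-++; ++-identityʳ; length-applyUpTo; filter-accept; filter-reject)
open import Data.List.Relation.Unary.All as All using (All; []; _∷_)
open import Data.List.Relation.Unary.All.Properties using (++⁺; ++⁻ˡ; ++⁻ʳ; map⁺; map⁻; All¬⇒¬Any; applyUpTo⁺₁)
open import Data.List.Relation.Unary.AllPairs using ([]; _∷_)
import Data.List.Relation.Unary.AllPairs.Properties as AllPairs
open import Data.List.Relation.Unary.Any using (here; there)
open import Data.List.Relation.Unary.Unique.Propositional using (Unique)
open import Data.Maybe using (Maybe; just; nothing)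
open import Data.Maybe.Properties using (just-injective)
open import Data.Nat using (ℕ; zero; suc; _+_; _*_; _∸_; _^_; _≤_; _<_; z≤n; s≤s; _≡ᵇ_; pred; _≟_; _<?_; NonZero)
open import Data.Nat.DivMod hiding (_/_)
open import Data.Nat.ListAction using (sum)
open import Data.Nat.Properties
open import Algebra.Properties.CommutativeSemigroup +-commutativeSemigroup using (x∙yz≈y∙xz)
open import Data.Nat.Solver renaming (module +-*-Solver to ℕ-Solver)
open import Data.Product using (Σ; _×_; _,_; ∃; ∃₂; ∃-syntax; proj₁; proj₂)
open import Data.Product.Function.NonDependent.Propositional using (_×-↔_)
open import Data.Rational using (ℚ; _/_; 1ℚ; fromℚᵘ)
import Data.Rational as ℚ
open import Data.Rational.Properties using (toℚᵘ-injective; toℚᵘ-fromℚᵘ; toℚᵘ-homo-+; toℚᵘ-homo-*; fromℚᵘ-cong)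
import Data.Rational.Properties as ℚₚ
open import Data.Rational.Solver renaming (module +-*-Solver to ℚ-Solver)
import Data.Rational.Unnormalised as ℚᵘ
import Data.Rational.Unnormalised.Properties as ℚᵘₚ
open import Data.Sum as Sum using (_⊎_; inj₁; inj₂)
open import Data.Sum.Function.Propositional using (_⊎-↔_)
open import Data.Unit using (⊤; tt)
open import Function using (_∘_)
open import Function.Bundles using (Equivalence; Inverse; _↔_; mk↔ₛ′)
open import Function.Properties.Inverse using (↔-refl; ↔-trans)
open import Relation.Binary.PropositionalEquality
open import Relation.Nullary using (Dec; yes; no)

-- States and edges

Ball : State → ℕ → Set
Ball (st i j _ _) k = k ≡ i ⊎ k ≡ j

seq⇒Ball : ∀ s k → T (seq s k) → Ball s k
seq⇒Ball (st i j _ _) k t = Sum.map (≡ᵇ⇒≡ k i) (≡ᵇ⇒≡ k j) (Equivalence.to T-∨ t)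

Ball⇒seq : ∀ s k → Ball s k → T (seq s k)
Ball⇒seq (st i j _ _) k b = Equivalence.from T-∨ (Sum.map (≡⇒≡ᵇ k i) (≡⇒≡ᵇ k j) b)

Ball⇒Edge : ∀ c d → (∀ k → 1 ≤ k → Ball c (suc k) → Ball d k) → Edge c d
Ball⇒Edge c d f k p t = Ball⇒seq d k (f k p (seq⇒Ball c (suc k) t))

Edge⇒Ball : ∀ c d → Edge c d → ∀ k → 1 ≤ k → Ball c (suc k) → Ball d k
Edge⇒Ball c d e k p m = seq⇒Ball d k (e k p (Ball⇒seq c (suc k) m))

st-cong : ∀ {i j i' j' p q p' q'} → i ≡ i' → j ≡ j' → st i j p q ≡ st i' j' p' q'
st-cong {p = p} {q} {p'} {q'} refl refl = cong₂ (st _ _) (≤-irrelevant p p') (≤-irrelevant q q')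

-- ready g = ⟨1, g + 2⟩ is the only kind of state with a choice of successor;
-- idle k g = ⟨k + 2, k + g + 3⟩ falls in k + 1 forced steps to ready g.
ready : ℕ → State
ready g = st 1 (suc (suc g)) (s≤s z≤n) (s≤s (s≤s z≤n))

idle : ℕ → ℕ → State
idle k g = st (suc (suc k)) (suc (suc k) + suc g) (s≤s z≤n) (m<m+n (suc (suc k)) (s≤s z≤n))

ready-injective : ∀ {g g'} → ready g ≡ ready g' → g ≡ g'
ready-injective refl = refl

idle-injective : ∀ {k g k' g'} → idle k g ≡ idle k' g' → k ≡ k' × g ≡ g'
idle-injective {k} eq with cong State.i eq | cong State.j eq
... | refl | j≡j' = refl , suc-injective (+-cancelˡ-≡ (suc (suc k)) _ _ j≡j')

ready-or-idle : ∀ (s : State) → (∃ λ g → s ≡ ready g) ⊎ (∃₂ λ k g → s ≡ idle k g)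
ready-or-idle (st (suc zero) (suc (suc g)) p q) = inj₁ (g , st-cong refl refl)
ready-or-idle (st (suc zero) (suc zero) p (s≤s ()))
ready-or-idle (st (suc (suc k)) j p q) =
  inj₂ (k , j ∸ suc (suc (suc k)) , st-cong refl (sym (trans (+-suc (suc (suc k)) _) (m+[n∸m]≡n q))))

idleRun : ℕ → ℕ → List State
idleRun zero g = []
idleRun (suc zero) g = []
idleRun (suc (suc k)) g = idle k g ∷ idleRun (suc k) g

length-idleRun : ∀ c g → length (idleRun c g) ≡ pred c
length-idleRun zero g = refl
length-idleRun (suc zero) g = refl
length-idleRun (suc (suc k)) g = cong suc (length-idleRun (suc k) g)

forced-step : ∀ c d → Edge c d → ∀ i → State.i c ≡ suc (suc i) →
              State.i d ≡ suc i × State.j d ≡ pred (State.j c)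
forced-step c@(st .(suc (suc i)) (suc j) p (s≤s q)) d@(st a b pa qa) e i refl
  with Edge⇒Ball c d e (suc i) (s≤s z≤n) (inj₁ refl) | Edge⇒Ball c d e j (≤-trans (s≤s z≤n) q) (inj₂ refl)
... | inj₁ x | inj₁ y = ⊥-elim (<-irrefl (trans x (sym y)) q)
... | inj₁ x | inj₂ y = sym x , sym y
... | inj₂ x | inj₁ y = ⊥-elim (<-asym q (subst₂ _<_ (sym y) (sym x) qa))
... | inj₂ x | inj₂ y = ⊥-elim (<-irrefl (trans x (sym y)) q)

idle-step : ∀ k g d → Edge (idle (suc k) g) d → d ≡ idle k g
idle-step k g d@(st _ _ _ _) e = let i≡ , j≡ = forced-step (idle (suc k) g) d e (suc k) refl in st-cong i≡ j≡

idle-land : ∀ g d → Edge (idle 0 g) d → d ≡ ready g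
idle-land g d@(st _ _ _ _) e = let i≡ , j≡ = forced-step (idle 0 g) d e 0 refl in st-cong i≡ j≡

shift-edge : ∀ c d → State.i c ≡ suc (State.i d) → State.j c ≡ suc (State.j d) → Edge c d
shift-edge c@(st _ _ _ _) d@(st _ _ _ _) refl refl =
  Ball⇒Edge c d λ { k _ (inj₁ refl) → inj₁ refl ; k _ (inj₂ refl) → inj₂ refl }

idle⟶idle : ∀ k g → Edge (idle (suc k) g) (idle k g)
idle⟶idle k g = shift-edge (idle (suc k) g) (idle k g) refl refl

idle⟶ready : ∀ g → Edge (idle 0 g) (ready g)
idle⟶ready g = shift-edge (idle 0 g) (ready g) refl refl

ready-edge : ∀ g d → Ball d (suc g) → Edge (ready g) d
ready-edge g d b = Ball⇒Edge (ready g) d λ { zero () _ ; (suc k) _ (inj₁ ()) ; (suc k) _ (inj₂ refl) → b }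

ready-edge⁻¹ : ∀ g d → Edge (ready g) d → Ball d (suc g)
ready-edge⁻¹ g d e = Edge⇒Ball (ready g) d e _ (s≤s z≤n) (inj₂ refl)

-- Cycles as sequences of blocks

-- A block (g , c) is the state ready g followed by the c ∸ 1 idle states before the
-- next ready state.
Blocks : Set
Blocks = List (ℕ × ℕ)

nextReady : Blocks → ℕ → ℕ
nextReady [] e = e
nextReady ((g , _) ∷ _) e = g

expand : Blocks → ℕ → List State
expand [] e = []
expand ((g , c) ∷ bs) e = ready g ∷ idleRun c (nextReady bs e) ++ expand bs e

period : Blocks → ℕ
period [] = 0
period ((_ , c) ∷ bs) = c + period bs

-- From ready g the new ball lands above the old one (c = g + 1, any next g'),
-- or below it, at height c, and then ready (g ∸ c) comes next.
Link : ℕ → ℕ → ℕ → Set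
Link g c g' = c ≡ suc g ⊎ (0 < c × c + g' ≡ g)

Linked : Blocks → ℕ → Set
Linked [] e = ⊤
Linked ((g , c) ∷ bs) e = Link g c (nextReady bs e) × Linked bs e

Link⇒pos : ∀ {g c g'} → Link g c g' → 1 ≤ c
Link⇒pos (inj₁ refl) = s≤s z≤n
Link⇒pos (inj₂ (p , _)) = p

data Path : List State → State → Set where
  [_]  : ∀ {x e} → Edge x e → Path (x ∷ []) e
  _∷_ : ∀ {x y ys e} → Edge x y → Path (y ∷ ys) e → Path (x ∷ y ∷ ys) e

Path-++ : ∀ {xs y ys e} → Path xs y → Path (y ∷ ys) e → Path (xs ++ y ∷ ys) e
Path-++ [ x ] w = x ∷ w
Path-++ (x ∷ w₁) w = x ∷ Path-++ w₁ w

Ball-ready⇒Link : ∀ g g' → Ball (ready g') (suc g) → Link g 1 g'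
Ball-ready⇒Link zero g' (inj₁ refl) = inj₁ refl
Ball-ready⇒Link g g' (inj₂ refl) = inj₂ (s≤s z≤n , refl)

Link⇒Ball-ready : ∀ g g' → Link g 1 g' → Ball (ready g') (suc g)
Link⇒Ball-ready g g' (inj₁ refl) = inj₁ refl
Link⇒Ball-ready g g' (inj₂ (_ , refl)) = inj₂ refl

Ball-idle⇒Link : ∀ g k g' → Ball (idle k g') (suc g) → Link g (suc (suc k)) g'
Ball-idle⇒Link g k g' (inj₁ e) = inj₁ (sym e)
Ball-idle⇒Link g k g' (inj₂ e) = inj₂ (s≤s z≤n , trans (cong suc (sym (+-suc k g'))) (suc-injective (sym e)))

Link⇒Ball-idle : ∀ g k g' → Link g (suc (suc k)) g' → Ball (idle k g') (suc g)
Link⇒Ball-idle g k g' (inj₁ e) = inj₁ (sym e)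
Link⇒Ball-idle g k g' (inj₂ (_ , e)) = inj₂ (cong suc (trans (sym e) (cong suc (sym (+-suc k g')))))

idleRun-path : ∀ k g → Path (idle k g ∷ idleRun (suc k) g) (ready g)
idleRun-path zero g = [ idle⟶ready g ]
idleRun-path (suc k) g = idle⟶idle k g ∷ idleRun-path k g

block-path : ∀ g c g' → Link g c g' → Path (ready g ∷ idleRun c g') (ready g')
block-path g zero g' (inj₂ (() , _))
block-path g (suc zero) g' l = [ ready-edge g (ready g') (Link⇒Ball-ready g g' l) ]
block-path g (suc (suc k)) g' l = ready-edge g (idle k g') (Link⇒Ball-idle g k g' l) ∷ idleRun-path k g'

expand-path : ∀ g c bs e → Linked ((g , c) ∷ bs) e → Path (expand ((g , c) ∷ bs) e) (ready e)
expand-path g c [] e (l , _) =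
  subst (λ xs → Path xs (ready e)) (sym (++-identityʳ (ready g ∷ idleRun c e))) (block-path g c e l)
expand-path g c ((g₁ , c₁) ∷ bs) e (l , ls) = Path-++ (block-path g c g₁ l) (expand-path g₁ c₁ bs e ls)

length-expand : ∀ bs e → Linked bs e → length (expand bs e) ≡ period bs
length-expand [] e _ = refl
length-expand ((g , c) ∷ bs) e (l , ls) with Link⇒pos l
... | s≤s {n = c'} z≤n =
  cong suc (trans (length-++ (idleRun (suc c') (nextReady bs e)))
                  (cong₂ _+_ (length-idleRun (suc c') _) (length-expand bs e ls)))

idle-path-split : ∀ k g xs e → Path (idle k g ∷ xs) (ready e) →
  (xs ≡ idleRun (suc k) g × g ≡ e) ⊎
  (∃ λ ys → xs ≡ idleRun (suc k) g ++ ready g ∷ ys × Path (ready g ∷ ys) (ready e))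
idle-path-split zero g [] e [ x ] = inj₁ (refl , ready-injective (sym (idle-land g (ready e) x)))
idle-path-split zero g (y ∷ ys) e (x ∷ w) with idle-land g y x
... | refl = inj₂ (ys , refl , w)
idle-path-split (suc k) g [] e [ x ] with idle-step k g (ready e) x
... | ()
idle-path-split (suc k) g (y ∷ ys) e (x ∷ w) with idle-step k g y x
... | refl with idle-path-split k g ys e w
... | inj₁ (refl , g≡e) = inj₁ (refl , g≡e)
... | inj₂ (ys' , refl , w') = inj₂ (ys' , refl , w')

-- the fuel n bounds the length of the path
path⇒blocks : ∀ n g xs e → length xs ≤ n → Path (ready g ∷ xs) (ready e) →
  ∃₂ λ c bs → ready g ∷ xs ≡ expand ((g , c) ∷ bs) e × Linked ((g , c) ∷ bs) e
path⇒blocks n g [] e _ [ x ] = 1 , [] , refl , Ball-ready⇒Link g e (ready-edge⁻¹ g (ready e) x) , tt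
path⇒blocks (suc n) g (y ∷ xs) e (s≤s len) (x ∷ w) with ready-or-idle y
... | inj₁ (g₁ , refl) with path⇒blocks n g₁ xs e len w
... | c₁ , bs , eq , ls = 1 , (g₁ , c₁) ∷ bs , cong (ready g ∷_) eq , Ball-ready⇒Link g g₁ (ready-edge⁻¹ g (ready g₁) x) , ls
path⇒blocks (suc n) g (y ∷ xs) e (s≤s len) (x ∷ w) | inj₂ (k , g' , refl) with idle-path-split k g' xs e w
... | inj₁ (refl , refl) =
  suc (suc k) , [] , cong (λ zs → ready g ∷ idle k g' ∷ zs) (sym (++-identityʳ _)) ,
  Ball-idle⇒Link g k g' (ready-edge⁻¹ g (idle k g') x) , tt
... | inj₂ (ys , refl , w') with path⇒blocks n g' ys e shorter w'
  where
  shorter : length ys ≤ n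
  shorter = begin
    length ys                                  ≤⟨ n≤1+n _ ⟩
    length (ready g' ∷ ys)                     ≤⟨ m≤n+m _ (length (idleRun (suc k) g')) ⟩
    length (idleRun (suc k) g') + length (ready g' ∷ ys) ≡⟨ length-++ (idleRun (suc k) g') ⟨
    length (idleRun (suc k) g' ++ ready g' ∷ ys) ≤⟨ len ⟩
    n                                          ∎
    where open ≤-Reasoning
... | c₁ , bs , eq , ls =
  suc (suc k) , (g' , c₁) ∷ bs , cong (λ zs → ready g ∷ idle k g' ∷ idleRun (suc k) g' ++ zs) eq ,
  Ball-idle⇒Link g k g' (ready-edge⁻¹ g (idle k g') x) , ls

nextReadys : Blocks → ℕ → List ℕ
nextReadys [] e = []
nextReadys (_ ∷ bs) e = nextReady bs e ∷ nextReadys bs e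

InIdleRun : ℕ → ℕ → State → Set
InIdleRun c g s = ∃ λ k → suc (suc k) ≤ c × s ≡ idle k g

InExpansion : List ℕ → List ℕ → State → Set
InExpansion gs hs s = (∃ λ g → g ∈ gs × s ≡ ready g) ⊎ (∃₂ λ k h → h ∈ hs × s ≡ idle k h)

idleRun-members : ∀ c g → All (InIdleRun c g) (idleRun c g)
idleRun-members zero g = []
idleRun-members (suc zero) g = []
idleRun-members (suc (suc k)) g =
  (k , ≤-refl , refl) ∷ All.map (λ { (k' , le , eq) → k' , m≤n⇒m≤1+n le , eq }) (idleRun-members (suc k) g)

idleRun-unique : ∀ c g → Unique (idleRun c g)
idleRun-unique zero g = []
idleRun-unique (suc zero) g = []
idleRun-unique (suc (suc k)) g =
  All.map (λ { (k' , le , refl) eq → <-irrefl (cong suc (sym (proj₁ (idle-injective eq)))) le }) (idleRun-members (suc k) g)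
  ∷ idleRun-unique (suc k) g

expand-members : ∀ bs e → All (InExpansion (map proj₁ bs) (nextReadys bs e)) (expand bs e)
expand-members [] e = []
expand-members ((g , c) ∷ bs) e =
  inj₁ (g , here refl , refl) ∷
  ++⁺ (All.map (λ { (k , _ , eq) → inj₂ (k , _ , here refl , eq) }) (idleRun-members c (nextReady bs e)))
      (All.map (λ { (inj₁ (g' , m , eq)) → inj₁ (g' , there m , eq) ; (inj₂ (k , h , m , eq)) → inj₂ (k , h , there m , eq) })
               (expand-members bs e))

expand-unique : ∀ bs e → Unique (map proj₁ bs) → Unique (nextReadys bs e) → Unique (expand bs e)
expand-unique [] e _ _ = []
expand-unique ((g , c) ∷ bs) e (g∉ ∷ gs!) (h∉ ∷ hs!) =
  ++⁺ (All.map (λ { (k , _ , refl) () }) (idleRun-members c (nextReady bs e)))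
      (All.map (λ { (inj₁ (g' , m , refl)) eq → All¬⇒¬Any g∉ (subst (_∈ _) (sym (ready-injective eq)) m)
                  ; (inj₂ (k , h , m , refl)) () })
               (expand-members bs e))
  ∷ AllPairs.++⁺ (idleRun-unique c _) (expand-unique bs e gs! hs!)
      (All.map (λ { (k , _ , refl) → All.map (λ { (inj₁ (g' , m , refl)) ()
                                                ; (inj₂ (k' , h , m , refl)) eq →
                                                    All¬⇒¬Any h∉ (subst (_∈ _) (sym (proj₂ (idle-injective eq))) m) })
                                              (expand-members bs e) })
               (idleRun-members c (nextReady bs e)))

StartsReady : List State → Set
StartsReady [] = ⊤
StartsReady (x ∷ _) = State.i x ≡ 1

expand-startsReady : ∀ bs e → StartsReady (expand bs e)
expand-startsReady [] e = tt
expand-startsReady (_ ∷ bs) e = refl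

idleRun-++-injective : ∀ c c' g g' xs xs' → 1 ≤ c → 1 ≤ c' → StartsReady xs → StartsReady xs' →
                       idleRun c g ++ xs ≡ idleRun c' g' ++ xs' → c ≡ c' × xs ≡ xs'
idleRun-++-injective (suc zero) (suc zero) g g' xs xs' _ _ _ _ eq = refl , eq
idleRun-++-injective (suc zero) (suc (suc k')) g g' (x ∷ xs) xs' _ _ () _ refl
idleRun-++-injective (suc (suc k)) (suc zero) g g' xs (x ∷ xs') _ _ _ () refl
idleRun-++-injective (suc (suc k)) (suc (suc k')) g g' xs xs' _ _ r r' eq
  with idleRun-++-injective (suc k) (suc k') g g' xs xs' (s≤s z≤n) (s≤s z≤n) r r' (proj₂ (∷-injective eq))
... | c≡c' , xs≡xs' = cong suc c≡c' , xs≡xs'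

expand-injective : ∀ bs bs' e e' → Linked bs e → Linked bs' e' → expand bs e ≡ expand bs' e' → bs ≡ bs'
expand-injective [] [] e e' _ _ _ = refl
expand-injective ((g , c) ∷ bs) ((g' , c') ∷ bs') e e' (l , ls) (l' , ls') eq
  with ready-injective (proj₁ (∷-injective eq))
... | refl with idleRun-++-injective c c' _ _ (expand bs e) (expand bs' e') (Link⇒pos l) (Link⇒pos l')
                  (expand-startsReady bs e) (expand-startsReady bs' e') (proj₂ (∷-injective eq))
... | refl , eq' = cong ((g , c) ∷_) (expand-injective bs bs' e e' ls ls' eq')

-- the canonical rotation of a cycle starts at its state of largest rank
rank : State → ℕ
rank (st i j _ _) = if i ≡ᵇ 1 then j else 0

expand-rank< : ∀ g₀ bs e → All (λ b → proj₁ b < g₀) bs → All (λ s → rank s < rank (ready g₀)) (expand bs e)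
expand-rank< g₀ bs e lt =
  All.map (λ { (inj₁ (g , m , refl)) → s≤s (s≤s (All.lookup (map⁺ lt) m)) ; (inj₂ (k , h , m , refl)) → s≤s z≤n })
          (expand-members bs e)

-- Canonical rotations

-- total indexing; the default is never reached below
at : List State → ℕ → State
at [] k = ready 0
at (x ∷ xs) zero = x
at (x ∷ xs) (suc k) = at xs k

All-at : ∀ {P : State → Set} {xs} → All P xs → ∀ k → k < length xs → P (at xs k)
All-at (p ∷ _) zero _ = p
All-at (_ ∷ ps) (suc k) (s≤s l) = All-at ps k l

at-applyUpTo : ∀ f m k → k < m → at (applyUpTo f m) k ≡ f k
at-applyUpTo f (suc m) zero _ = refl
at-applyUpTo f (suc m) (suc k) (s≤s l) = at-applyUpTo (λ i → f (suc i)) m k l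

at-ext : ∀ xs ys → length xs ≡ length ys → (∀ k → k < length xs → at xs k ≡ at ys k) → xs ≡ ys
at-ext [] [] _ _ = refl
at-ext (x ∷ xs) (y ∷ ys) l f = cong₂ _∷_ (f 0 (s≤s z≤n)) (at-ext xs ys (suc-injective l) (λ k p → f (suc k) (s≤s p)))

Unique⇒at-injective : ∀ xs → Unique xs → ∀ a b → a < length xs → b < length xs → at xs a ≡ at xs b → a ≡ b
Unique⇒at-injective (x ∷ xs) u zero zero _ _ _ = refl
Unique⇒at-injective (x ∷ xs) (x∉ ∷ u) zero (suc b) _ (s≤s lb) eq = ⊥-elim (All-at x∉ b lb eq)
Unique⇒at-injective (x ∷ xs) (x∉ ∷ u) (suc a) zero (s≤s la) _ eq = ⊥-elim (All-at x∉ a la (sym eq))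
Unique⇒at-injective (x ∷ xs) (x∉ ∷ u) (suc a) (suc b) (s≤s la) (s≤s lb) eq =
  cong suc (Unique⇒at-injective xs u a b la lb eq)

Path-at : ∀ {xs e} → Path xs e → ∀ k → suc k < length xs → Edge (at xs k) (at xs (suc k))
Path-at [ x ] k (s≤s ())
Path-at (x ∷ w) zero _ = x
Path-at (x ∷ w) (suc k) (s≤s l) = Path-at w k l

Path-last : ∀ {xs e} → Path xs e → Edge (at xs (pred (length xs))) e
Path-last [ x ] = x
Path-last (x ∷ w) = Path-last w

applyUpTo-path : ∀ f m e → (∀ k → k < m → Edge (f k) (f (suc k))) → Edge (f m) e → Path (applyUpTo f (suc m)) e
applyUpTo-path f zero e h l = [ l ]
applyUpTo-path f (suc m) e h l = h 0 (s≤s z≤n) ∷ applyUpTo-path (λ k → f (suc k)) m e (λ k lk → h (suc k) (s≤s lk)) l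

[m+n%d]%d≡[m+n]%d : ∀ m n d .{{_ : NonZero d}} → (m + n % d) % d ≡ (m + n) % d
[m+n%d]%d≡[m+n]%d m n d = begin
  (m + n % d) % d         ≡⟨ %-distribˡ-+ m (n % d) d ⟩
  (m % d + n % d % d) % d ≡⟨ cong (λ z → (m % d + z) % d) (m%n%n≡m%n n d) ⟩
  (m % d + n % d) % d     ≡⟨ %-distribˡ-+ m n d ⟨
  (m + n) % d             ∎
  where open ≡-Reasoning

-- adding d ∸ r undoes the rotation by r
+-%-cancelˡ : ∀ {d} .{{_ : NonZero d}} r {a b} → r ≤ d → a < d → b < d → (r + a) % d ≡ (r + b) % d → a ≡ b
+-%-cancelˡ {d} r {a} {b} r≤d a<d b<d eq = trans (sym (unrotate a a<d)) (trans (cong (λ z → (z + (d ∸ r)) % d) eq) (unrotate b b<d))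
  where
  unrotate : ∀ x → x < d → ((r + x) % d + (d ∸ r)) % d ≡ x
  unrotate x x<d = begin
    ((r + x) % d + (d ∸ r)) % d ≡⟨ cong (_% d) (+-comm ((r + x) % d) (d ∸ r)) ⟩
    ((d ∸ r) + (r + x) % d) % d ≡⟨ [m+n%d]%d≡[m+n]%d (d ∸ r) (r + x) d ⟩
    ((d ∸ r) + (r + x)) % d     ≡⟨ cong (_% d) (trans (sym (+-assoc (d ∸ r) r x)) (cong (_+ x) (m∸n+n≡m r≤d))) ⟩
    (d + x) % d                 ≡⟨ cong (_% d) (+-comm d x) ⟩
    (x + d) % d                 ≡⟨ [m+n]%n≡m%n x d ⟩
    x % d                       ≡⟨ m<n⇒m%n≡m x<d ⟩
    x                           ∎
    where open ≡-Reasoning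

cycleFrom : ∀ n xs → length xs ≡ suc n → Path xs (at xs 0) → Unique xs → Cycle (suc n)
cycleFrom n xs len w u = record
  { v = λ k → at xs (k % suc n)
  ; periodic = λ k → cong (at xs) ([m+n]%n≡m%n k (suc n))
  ; edges = edge
  ; distinct = λ a b a< b< eq →
      Unique⇒at-injective xs u a b (subst (a <_) (sym len) a<) (subst (b <_) (sym len) b<)
        (trans (cong (at xs) (sym (m<n⇒m%n≡m a<))) (trans eq (cong (at xs) (m<n⇒m%n≡m b<))))
  }
  where
  next : ∀ k → suc k % suc n ≡ suc (k % suc n) % suc n
  next k = sym ([m+n%d]%d≡[m+n]%d 1 k (suc n))
  edge : ∀ k → Edge (at xs (k % suc n)) (at xs (suc k % suc n))
  edge k with suc (k % suc n) <? suc n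
  ... | yes lt = subst (λ z → Edge (at xs (k % suc n)) (at xs z)) (sym (trans (next k) (m<n⇒m%n≡m lt)))
                   (Path-at w (k % suc n) (subst (suc (k % suc n) <_) (sym len) lt))
  ... | no ¬lt = subst₂ (λ a b → Edge (at xs a) (at xs b)) last≡ (sym (trans (next k) wrap)) (Path-last w)
    where
    top : suc (k % suc n) ≡ suc n
    top = ≤-antisym (m%n<n k (suc n)) (≮⇒≥ ¬lt)
    last≡ : pred (length xs) ≡ k % suc n
    last≡ = trans (cong pred len) (suc-injective (sym top))
    wrap : suc (k % suc n) % suc n ≡ 0
    wrap = trans (cong (_% suc n) top) (n%n≡0 (suc n))

Canonical : List State → Set
Canonical [] = ⊤
Canonical (x ∷ xs) = All (λ y → rank y < rank x) xs

Canonical-at : ∀ xs → Canonical xs → ∀ k → 1 ≤ k → k < length xs → rank (at xs k) < rank (at xs 0)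
Canonical-at (x ∷ xs) c (suc k) _ (s≤s l) = All-at c k l

≈c-canonical⇒≡ : ∀ n xs ys lx ly wx wy ux uy → Canonical xs → Canonical ys →
                 cycleFrom n xs lx wx ux ≈c cycleFrom n ys ly wy uy → xs ≡ ys
≈c-canonical⇒≡ n xs ys lx ly wx wy ux uy cx cy (r , shift) with r % suc n in r%
... | zero = at-ext xs ys (trans lx (sym ly)) λ k k<len →
      let k< = subst (k <_) lx k<len in
      sym (trans (cong (at ys) (sym (m<n⇒m%n≡m k<))) (trans (shift k) (cong (at xs) (shifted k k< ))))
  where
  shifted : ∀ k → k < suc n → (k + r) % suc n ≡ k
  shifted k k< = trans (sym ([m+n%d]%d≡[m+n]%d k r (suc n)))
                       (trans (cong (λ z → (k + z) % suc n) r%) (trans (cong (_% suc n) (+-identityʳ k)) (m<n⇒m%n≡m k<)))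
... | suc t = ⊥-elim (<-asym ys<xs xs<ys)
  where
  N : ℕ
  N = suc n
  t< : suc t < N
  t< = subst (_< N) r% (m%n<n r N)
  rot : ∀ k → (k + r) % N ≡ (k + suc t) % N
  rot k = trans (sym ([m+n%d]%d≡[m+n]%d k r N)) (cong (λ z → (k + z) % N) r%)
  ys₀ : at ys 0 ≡ at xs (suc t)
  ys₀ = trans (shift 0) (cong (at xs) (trans (rot 0) (m<n⇒m%n≡m t<)))
  ys<xs : rank (at ys 0) < rank (at xs 0)
  ys<xs = subst (λ z → rank z < rank (at xs 0)) (sym ys₀)
                (Canonical-at xs cx (suc t) (s≤s z≤n) (subst (suc t <_) (sym lx) t<))
  k₀ : ℕ
  k₀ = N ∸ suc t
  ysₖ : at ys k₀ ≡ at xs 0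
  ysₖ = trans (cong (at ys) (sym (m<n⇒m%n≡m (s≤s (m∸n≤m n t)))))
              (trans (shift k₀) (cong (at xs) (trans (rot k₀) (trans (cong (_% N) (m∸n+n≡m (<⇒≤ t<))) (n%n≡0 N)))))
  xs<ys : rank (at xs 0) < rank (at ys 0)
  xs<ys = subst (λ z → rank z < rank (at ys 0)) ysₖ
                (Canonical-at ys cy k₀ (m<n⇒0<n∸m t<) (subst (k₀ <_) (sym ly) (s≤s (m∸n≤m n t))))

argmax : (ℕ → ℕ) → ℕ → ℕ
argmax f zero = 0
argmax f (suc m) with f (argmax f m) <? f (suc m)
... | yes _ = suc m
... | no _ = argmax f m

argmax≤ : ∀ (f : ℕ → ℕ) m → argmax f m ≤ m
argmax≤ f zero = z≤n
argmax≤ f (suc m) with f (argmax f m) <? f (suc m)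
... | yes _ = ≤-refl
... | no _ = m≤n⇒m≤1+n (argmax≤ f m)

argmax-max : ∀ (f : ℕ → ℕ) m k → k ≤ m → f k ≤ f (argmax f m)
argmax-max f zero zero _ = ≤-refl
argmax-max f (suc m) k k≤ with f (argmax f m) <? f (suc m) | m≤n⇒m<n∨m≡n k≤
... | yes p | inj₁ (s≤s k≤m) = ≤-trans (argmax-max f m k k≤m) (<⇒≤ p)
... | yes p | inj₂ refl = ≤-refl
... | no p | inj₁ (s≤s k≤m) = argmax-max f m k k≤m
... | no p | inj₂ refl = ≮⇒≥ p

i≡1⇒0<rank : ∀ s → State.i s ≡ 1 → 0 < rank s
i≡1⇒0<rank (st (suc zero) (suc j) _ _) _ = s≤s z≤n

0<rank⇒ready : ∀ s → 0 < rank s → ∃ λ g → s ≡ ready g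
0<rank⇒ready s pos with ready-or-idle s
... | inj₁ r = r
... | inj₂ (k , g , refl) with pos
... | ()

rank-injective : ∀ s s' → rank s ≡ rank s' → 0 < rank s → s ≡ s'
rank-injective s s' eq pos with 0<rank⇒ready s pos | 0<rank⇒ready s' (subst (0 <_) eq pos)
... | g , refl | g' , refl = cong ready (suc-injective (suc-injective eq))

module Rotation (n : ℕ) (C : Cycle (suc n)) where

  N : ℕ
  N = suc n

  v-%-periodic : ∀ k → v C k ≡ v C (k % N)
  v-%-periodic k = trans (cong (v C) (m≡m%n+[m/n]*n k N)) (periodic* (k % N) (k Data.Nat./ N))
    where
    periodic* : ∀ a q → v C (a + q * N) ≡ v C a
    periodic* a zero = cong (v C) (+-identityʳ a)
    periodic* a (suc q) =
      trans (cong (v C) (trans (cong (a +_) (+-comm N (q * N))) (sym (+-assoc a (q * N) N))))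
            (trans (periodic C (a + q * N)) (periodic* a q))

  ≡⇒%≡ : ∀ a b → v C a ≡ v C b → a % N ≡ b % N
  ≡⇒%≡ a b eq = distinct C (a % N) (b % N) (m%n<n a N) (m%n<n b N)
                  (trans (sym (v-%-periodic a)) (trans eq (v-%-periodic b)))

  fall : ∀ m x → State.i (v C x) ≡ suc m → State.i (v C (x + m)) ≡ 1
  fall zero x eq = subst (λ z → State.i (v C z) ≡ 1) (sym (+-identityʳ x)) eq
  fall (suc m) x eq = subst (λ z → State.i (v C z) ≡ 1) (sym (+-suc x m))
                        (fall m (suc x) (proj₁ (forced-step (v C x) (v C (suc x)) (edges C x) m eq)))

  some-ready : ∃ λ k → State.i (v C k) ≡ 1
  some-ready with v C 0 in v₀
  ... | st (suc m) j p q = m , fall m 0 (cong State.i v₀)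

  rank-at : ℕ → ℕ
  rank-at k = rank (v C k)

  top : ℕ
  top = argmax rank-at n

  top<N : top < N
  top<N = s≤s (argmax≤ rank-at n)

  rank≤top : ∀ k → rank (v C k) ≤ rank (v C top)
  rank≤top k = ≤-trans (≤-reflexive (cong rank (v-%-periodic k))) (argmax-max rank-at n (k % N) (≤-pred (m%n<n k N)))

  0<rank-top : 0 < rank (v C top)
  0<rank-top = ≤-trans (i≡1⇒0<rank (v C (proj₁ some-ready)) (proj₂ some-ready)) (rank≤top (proj₁ some-ready))

  rotated-at : ℕ → State
  rotated-at k = v C (top + k)

  rotated : List State
  rotated = applyUpTo rotated-at N

  length-rotated : length rotated ≡ N
  length-rotated = length-applyUpTo rotated-at N

  rotated-injective : ∀ a b → a < N → b < N → rotated-at a ≡ rotated-at b → a ≡ b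
  rotated-injective a b a< b< eq = +-%-cancelˡ top (<⇒≤ top<N) a< b< (≡⇒%≡ (top + a) (top + b) eq)

  rotated-unique : Unique rotated
  rotated-unique = AllPairs.applyUpTo⁺₁ rotated-at N λ {a} {b} a<b b<N eq →
    <⇒≢ a<b (rotated-injective a b (<-trans a<b b<N) b<N eq)

  rotated-path : Path rotated (at rotated 0)
  rotated-path = applyUpTo-path rotated-at n (rotated-at 0)
    (λ k _ → subst (λ z → Edge (rotated-at k) (v C z)) (sym (+-suc top k)) (edges C (top + k)))
    (subst (Edge (rotated-at n)) wrap (edges C (top + n)))
    where
    wrap : v C (suc (top + n)) ≡ rotated-at 0
    wrap = trans (cong (v C) (sym (+-suc top n))) (trans (periodic C top) (cong (v C) (sym (+-identityʳ top))))

  rotated-canonical : Canonical rotated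
  rotated-canonical = applyUpTo⁺₁ (λ k → rotated-at (suc k)) n λ {k} k<n →
    subst (λ z → rank (rotated-at (suc k)) < rank z) (cong (v C) (sym (+-identityʳ top)))
          (≤∧≢⇒< (rank≤top (top + suc k)) λ eq →
            0≢1+n (sym (rotated-injective (suc k) 0 (s≤s k<n) (s≤s z≤n)
              (trans (rank-injective _ _ eq (subst (0 <_) (sym eq) 0<rank-top)) (cong (v C) (sym (+-identityʳ top)))))))

  rotated-head : ∃ λ g₀ → rotated-at 0 ≡ ready g₀
  rotated-head = 0<rank⇒ready (rotated-at 0) (subst (λ z → 0 < rank z) (cong (v C) (sym (+-identityʳ top))) 0<rank-top)

  ≈c-rotated : ∀ w u → C ≈c cycleFrom n rotated length-rotated w u
  ≈c-rotated w u = top , λ k → begin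
    at rotated (k % N)           ≡⟨ at-applyUpTo rotated-at N (k % N) (m%n<n k N) ⟩
    v C (top + k % N)            ≡⟨ v-%-periodic _ ⟩
    v C ((top + k % N) % N)      ≡⟨ cong (v C) ([m+n%d]%d≡[m+n]%d top k N) ⟩
    v C ((top + k) % N)          ≡⟨ v-%-periodic _ ⟨
    v C (top + k)                ≡⟨ cong (v C) (+-comm top k) ⟩
    v C (k + top)                ∎
    where open ≡-Reasoning

CanonicalBlocks : Blocks → Set
CanonicalBlocks [] = ⊤
CanonicalBlocks ((g , c) ∷ bs) = All (λ b → proj₁ b < g) bs × Unique (map proj₁ bs) × Linked ((g , c) ∷ bs) g

Unique-++⁻ʳ : ∀ {A : Set} (xs : List A) {ys} → Unique (xs ++ ys) → Unique ys
Unique-++⁻ʳ [] u = u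
Unique-++⁻ʳ (x ∷ xs) (_ ∷ u) = Unique-++⁻ʳ xs u

expand-heads : ∀ {P : State → Set} bs e → All P (expand bs e) → All (λ b → P (ready (proj₁ b))) bs
expand-heads [] e _ = []
expand-heads ((g , c) ∷ bs) e (p ∷ ps) = p ∷ expand-heads bs e (++⁻ʳ (idleRun c (nextReady bs e)) ps)

expand-unique⁻ : ∀ bs e → Unique (expand bs e) → Unique (map proj₁ bs)
expand-unique⁻ [] e _ = []
expand-unique⁻ ((g , c) ∷ bs) e (g∉ ∷ u) =
  map⁺ (All.map (λ ≢ready ≡g → ≢ready (cong ready ≡g)) (expand-heads bs e (++⁻ʳ (idleRun c (nextReady bs e)) g∉)))
  ∷ expand-unique⁻ bs e (Unique-++⁻ʳ (idleRun c (nextReady bs e)) u)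

canonicalBlocks : ∀ g₀ c₀ bs → Canonical (expand ((g₀ , c₀) ∷ bs) g₀) → Unique (expand ((g₀ , c₀) ∷ bs) g₀) →
                  Linked ((g₀ , c₀) ∷ bs) g₀ → CanonicalBlocks ((g₀ , c₀) ∷ bs)
canonicalBlocks g₀ c₀ bs can (_ ∷ u) ls =
  All.map (λ { (s≤s (s≤s l)) → l }) (expand-heads bs g₀ (++⁻ʳ (idleRun c₀ (nextReady bs g₀)) can)) ,
  expand-unique⁻ bs g₀ (Unique-++⁻ʳ (idleRun c₀ (nextReady bs g₀)) u) ,
  ls

nextReadys-values : ∀ bs e → nextReady bs e ∷ nextReadys bs e ≡ map proj₁ bs ++ e ∷ []
nextReadys-values [] e = refl
nextReadys-values ((g , c) ∷ bs) e = cong (g ∷_) (nextReadys-values bs e)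

module Expansion (g₀ c₀ : ℕ) (bs : Blocks) (cb : CanonicalBlocks ((g₀ , c₀) ∷ bs)) where

  private
    below : All (λ b → proj₁ b < g₀) bs
    below = proj₁ cb

  states : List State
  states = expand ((g₀ , c₀) ∷ bs) g₀

  states-path : Path states (at states 0)
  states-path = expand-path g₀ c₀ bs g₀ (proj₂ (proj₂ cb))

  states-unique : Unique states
  states-unique = expand-unique ((g₀ , c₀) ∷ bs) g₀
    (map⁺ (All.map (λ b<g₀ → >⇒≢ b<g₀) below) ∷ proj₁ (proj₂ cb))
    (subst Unique (sym (nextReadys-values bs g₀))
      (AllPairs.++⁺ (proj₁ (proj₂ cb)) ([] ∷ []) (map⁺ (All.map (λ b<g₀ → <⇒≢ b<g₀ ∷ []) below))))

  states-canonical : Canonical states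
  states-canonical = ++⁺ (All.map (λ { (k , _ , refl) → s≤s z≤n }) (idleRun-members c₀ (nextReady bs g₀)))
                         (expand-rank< g₀ bs g₀ below)

  length-states : length states ≡ period ((g₀ , c₀) ∷ bs)
  length-states = length-expand ((g₀ , c₀) ∷ bs) g₀ (proj₂ (proj₂ cb))


-- Marked lists

-- A marked list records the ready values of a canonical rotation in order,
-- each flagged high (the ball thrown from it lands above the other ball) or low.
Marked : Set
Marked = List (ℕ × Bool)

#high : Marked → ℕ
#high [] = 0
#high ((_ , true) ∷ xs) = suc (#high xs)
#high ((_ , false) ∷ xs) = #high xs

-- insert e j v xs puts (v , high) right after the e-th high entry, which stays
-- high when j = false and turns low when j = true; remove v undoes this and
-- position v recovers (e , j).
insert : ℕ → Bool → ℕ → Marked → Marked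
insert e j v [] = (v , true) ∷ []
insert e j v ((g , false) ∷ xs) = (g , false) ∷ insert e j v xs
insert zero j v ((g , true) ∷ xs) = (g , not j) ∷ (v , true) ∷ xs
insert (suc e) j v ((g , true) ∷ xs) = (g , true) ∷ insert e j v xs

removeAfter : ℕ × Bool → ℕ → Marked → Marked
removeAfter p v [] = p ∷ []
removeAfter p v ((g , b) ∷ xs) with g ≟ v
... | yes _ = (proj₁ p , true) ∷ xs
... | no _ = p ∷ removeAfter (g , b) v xs

remove : ℕ → Marked → Marked
remove v [] = []
remove v ((g , b) ∷ xs) with g ≟ v
... | yes _ = xs
... | no _ = removeAfter (g , b) v xs

positionAfter : ℕ → ℕ × Bool → ℕ → Marked → ℕ × Bool
positionAfter k p v [] = (0 , false)
positionAfter k (g₁ , b₁) v ((g , b) ∷ xs) with g ≟ v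
... | yes _ = (k , not b₁)
... | no _ = positionAfter (if b₁ then suc k else k) (g , b) v xs

position : ℕ → Marked → ℕ × Bool
position v [] = (0 , false)
position v (x ∷ xs) = positionAfter 0 x v xs

values : Marked → List ℕ
values = map proj₁

Absent : ℕ → Marked → Set
Absent v xs = All (λ p → proj₁ p ≢ v) xs

positionAfter-≢ : ∀ k g₁ b₁ g b v xs → g ≢ v →
  positionAfter k (g₁ , b₁) v ((g , b) ∷ xs) ≡ positionAfter (if b₁ then suc k else k) (g , b) v xs
positionAfter-≢ k g₁ b₁ g b v xs ne with g ≟ v
... | yes p = ⊥-elim (ne p)
... | no _ = refl

positionAfter-≡ : ∀ k g₁ b₁ g b v xs → g ≡ v → positionAfter k (g₁ , b₁) v ((g , b) ∷ xs) ≡ (k , not b₁)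
positionAfter-≡ k g₁ b₁ g b v xs e with g ≟ v
... | yes _ = refl
... | no ne = ⊥-elim (ne e)

removeAfter-≢ : ∀ p g b v xs → g ≢ v → removeAfter p v ((g , b) ∷ xs) ≡ p ∷ removeAfter (g , b) v xs
removeAfter-≢ p g b v xs ne with g ≟ v
... | yes e = ⊥-elim (ne e)
... | no _ = refl

removeAfter-≡ : ∀ p g b v xs → g ≡ v → removeAfter p v ((g , b) ∷ xs) ≡ (proj₁ p , true) ∷ xs
removeAfter-≡ p g b v xs e with g ≟ v
... | yes _ = refl
... | no ne = ⊥-elim (ne e)

remove-≢ : ∀ g b v xs → g ≢ v → remove v ((g , b) ∷ xs) ≡ removeAfter (g , b) v xs
remove-≢ g b v xs ne with g ≟ v
... | yes e = ⊥-elim (ne e)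
... | no _ = refl

remove-≡ : ∀ g b v xs → g ≡ v → remove v ((g , b) ∷ xs) ≡ xs
remove-≡ g b v xs e with g ≟ v
... | yes _ = refl
... | no ne = ⊥-elim (ne e)

positionAfter-insert : ∀ k x xs e j v → e < #high (x ∷ xs) → Absent v xs → proj₁ x ≢ v →
  ∃₂ λ x' rest → insert e j v (x ∷ xs) ≡ x' ∷ rest × proj₁ x' ≡ proj₁ x ×
                 positionAfter k x' v rest ≡ (k + e , j)
positionAfter-insert k (g , false) (y ∷ ys) e j v lt (ny ∷ nys) nx with positionAfter-insert k y ys e j v lt nys ny
... | (gy , by) , rest' , eq' , hy , inf = (g , false) , (gy , by) ∷ rest' , cong ((g , false) ∷_) eq' , refl ,
        trans (positionAfter-≢ k g false gy by v rest' (λ p → ny (trans (sym hy) p))) inf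
positionAfter-insert k (g , true) xs zero j v lt nxs nx = (g , not j) , (v , true) ∷ xs , refl , refl ,
        trans (positionAfter-≡ k g (not j) v true v xs refl) (cong₂ _,_ (sym (+-identityʳ k)) (not-involutive j))
positionAfter-insert k (g , true) (y ∷ ys) (suc e) j v (s≤s lt) (ny ∷ nys) nx
  with positionAfter-insert (suc k) y ys e j v lt nys ny
... | (gy , by) , rest' , eq' , hy , inf = (g , true) , (gy , by) ∷ rest' , cong ((g , true) ∷_) eq' , refl ,
        trans (positionAfter-≢ k g true gy by v rest' (λ p → ny (trans (sym hy) p))) (trans inf (cong (_, j) (sym (+-suc k e))))

position-insert : ∀ x xs e j v → e < #high (x ∷ xs) → Absent v (x ∷ xs) → position v (insert e j v (x ∷ xs)) ≡ (e , j)
position-insert x xs e j v lt (nx ∷ nxs) with positionAfter-insert 0 x xs e j v lt nxs nx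
... | x' , rest , eq , _ , inf = trans (cong (position v) eq) inf

removeAfter-insert : ∀ x xs e j v → e < #high (x ∷ xs) → Absent v xs → proj₁ x ≢ v →
  ∃₂ λ x' rest → insert e j v (x ∷ xs) ≡ x' ∷ rest × proj₁ x' ≡ proj₁ x × removeAfter x' v rest ≡ x ∷ xs
removeAfter-insert (g , false) ((gy , by) ∷ ys) e j v lt (ny ∷ nys) nx with removeAfter-insert (gy , by) ys e j v lt nys ny
... | (gy' , by') , rest' , eq' , refl , r = (g , false) , (gy , by') ∷ rest' , cong ((g , false) ∷_) eq' , refl ,
        trans (removeAfter-≢ (g , false) gy by' v rest' ny) (cong ((g , false) ∷_) r)
removeAfter-insert (g , true) xs zero j v lt nxs nx =
  (g , not j) , (v , true) ∷ xs , refl , refl , removeAfter-≡ (g , not j) v true v xs refl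
removeAfter-insert (g , true) ((gy , by) ∷ ys) (suc e) j v (s≤s lt) (ny ∷ nys) nx
  with removeAfter-insert (gy , by) ys e j v lt nys ny
... | (gy' , by') , rest' , eq' , refl , r = (g , true) , (gy , by') ∷ rest' , cong ((g , true) ∷_) eq' , refl ,
        trans (removeAfter-≢ (g , true) gy by' v rest' ny) (cong ((g , true) ∷_) r)

remove-insert : ∀ x xs e j v → e < #high (x ∷ xs) → Absent v (x ∷ xs) → remove v (insert e j v (x ∷ xs)) ≡ x ∷ xs
remove-insert x xs e j v lt (nx ∷ nxs) with removeAfter-insert x xs e j v lt nxs nx
... | (g' , b') , rest , eq , h , r = trans (cong (remove v) eq) (trans (remove-≢ g' b' v rest (λ p → nx (trans (sym h) p))) r)

HighIn : ℕ → Marked → Set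
HighIn v [] = ⊥
HighIn v ((g , b) ∷ ys) = (g ≡ v × b ≡ true) ⊎ (g ≢ v × HighIn v ys)

removeAfter-inverse : ∀ x xs v → HighIn v xs →
  ∃₂ λ e j → insert e j v (removeAfter x v xs) ≡ x ∷ xs × e < #high (removeAfter x v xs)
removeAfter-inverse (g , b) ((v , true) ∷ ys) v (inj₁ (refl , refl)) rewrite removeAfter-≡ (g , b) v true v ys refl =
  0 , not b , cong (λ b' → (g , b') ∷ (v , true) ∷ ys) (not-involutive b) , s≤s z≤n
removeAfter-inverse (g , false) ((g' , b') ∷ ys) v (inj₂ (g'≢v , v∈)) rewrite removeAfter-≢ (g , false) g' b' v ys g'≢v
  with removeAfter-inverse (g' , b') ys v v∈
... | e , j , ins≡ , e< = e , j , cong ((g , false) ∷_) ins≡ , e<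
removeAfter-inverse (g , true) ((g' , b') ∷ ys) v (inj₂ (g'≢v , v∈)) rewrite removeAfter-≢ (g , true) g' b' v ys g'≢v
  with removeAfter-inverse (g' , b') ys v v∈
... | e , j , ins≡ , e< = suc e , j , cong ((g , true) ∷_) ins≡ , s≤s e<




nextValue : Marked → ℕ → ℕ
nextValue [] e = e
nextValue ((g , _) ∷ _) e = g

LowsDescend : Marked → ℕ → Set
LowsDescend [] e = ⊤
LowsDescend ((g , b) ∷ xs) e = (b ≡ false → nextValue xs e < g) × LowsDescend xs e

Admissible : Marked → Set
Admissible [] = ⊤
Admissible ((g , b) ∷ xs) = All (λ p → proj₁ p < g) xs × Unique (map proj₁ xs) × LowsDescend ((g , b) ∷ xs) g

All-delete : ∀ {A : Set} {P : A → Set} (pre : List A) v post → All P (pre ++ v ∷ post) → All P (pre ++ post)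
All-delete pre v post a = ++⁺ (++⁻ˡ pre a) (All.tail (++⁻ʳ pre a))

All-insert : ∀ {A : Set} {P : A → Set} (pre : List A) v post → All P (pre ++ post) → P v → All P (pre ++ v ∷ post)
All-insert pre v post a p = ++⁺ (++⁻ˡ pre a) (p ∷ ++⁻ʳ pre a)

Unique-delete : ∀ {A : Set} (pre : List A) v post → Unique (pre ++ v ∷ post) → Unique (pre ++ post)
Unique-delete [] v post (_ ∷ u) = u
Unique-delete (x ∷ pre) v post (x∉ ∷ u) = All-delete pre v post x∉ ∷ Unique-delete pre v post u

Unique-insert : ∀ {A : Set} (pre : List A) v post → Unique (pre ++ post) → All (λ y → v ≢ y) (pre ++ post) →
  Unique (pre ++ v ∷ post)
Unique-insert [] v post u v∉ = v∉ ∷ u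
Unique-insert (x ∷ pre) v post (x∉ ∷ u) (v≢x ∷ v∉) =
  All-insert pre v post x∉ (≢-sym v≢x) ∷ Unique-insert pre v post u v∉

insert-split : ∀ x xs e j v → e < #high (x ∷ xs) → ∃ λ x' → ∃ λ rest → ∃ λ pre → ∃ λ post →
  insert e j v (x ∷ xs) ≡ x' ∷ rest × proj₁ x' ≡ proj₁ x × values xs ≡ pre ++ post × values rest ≡ pre ++ v ∷ post
insert-split (g , false) (y ∷ ys) e j v lt with insert-split y ys e j v lt
... | y' , rest , pre , post , eq , h , e1 , e2 =
  (g , false) , y' ∷ rest , proj₁ y ∷ pre , post , cong ((g , false) ∷_) eq , refl , cong (proj₁ y ∷_) e1 , cong₂ _∷_ h e2
insert-split (g , true) xs zero j v lt = (g , not j) , (v , true) ∷ xs , [] , values xs , refl , refl , refl , refl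
insert-split (g , true) (y ∷ ys) (suc e) j v (s≤s lt) with insert-split y ys e j v lt
... | y' , rest , pre , post , eq , h , e1 , e2 =
  (g , true) , y' ∷ rest , proj₁ y ∷ pre , post , cong ((g , true) ∷_) eq , refl , cong (proj₁ y ∷_) e1 , cong₂ _∷_ h e2

removeAfter-split : ∀ x xs v → HighIn v xs → ∃ λ pre → ∃ λ post →
  values xs ≡ pre ++ v ∷ post × values (removeAfter x v xs) ≡ proj₁ x ∷ pre ++ post
removeAfter-split x ((gy , by) ∷ ys) v (inj₁ (refl , refl)) =
  [] , values ys , refl , cong values (removeAfter-≡ x gy true gy ys refl)
removeAfter-split x ((gy , by) ∷ ys) v (inj₂ (ny , o)) with removeAfter-split (gy , by) ys v o
... | pre , post , e1 , e2 =
  gy ∷ pre , post , cong (gy ∷_) e1 , trans (cong values (removeAfter-≢ x gy by v ys ny)) (cong (proj₁ x ∷_) e2)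

nextValue-insert : ∀ e j v x xs → e < #high (x ∷ xs) → ∀ E → nextValue (insert e j v (x ∷ xs)) E ≡ proj₁ x
nextValue-insert e j v x xs lt E with insert-split x xs e j v lt
... | x' , rest , _ , _ , eq , h , _ = trans (cong (λ z → nextValue z E) eq) h

LowsDescend-insert : ∀ e j v S E → LowsDescend S E → All (λ p → v < proj₁ p) S → e < #high S →
  LowsDescend (insert e j v S) E
LowsDescend-insert e j v ((g , false) ∷ (y ∷ ys)) E (h , bk) (_ ∷ av) lt =
  (λ p → subst (_< g) (sym (nextValue-insert e j v y ys lt E)) (h p)) , LowsDescend-insert e j v (y ∷ ys) E bk av lt
LowsDescend-insert zero j v ((g , true) ∷ xs) E (h , bk) (vg ∷ av) lt =
  (λ p → subst (λ z → v < z) refl vg) , (λ ()) , bk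
LowsDescend-insert (suc e) j v ((g , true) ∷ (y ∷ ys)) E (h , bk) (_ ∷ av) (s≤s lt) =
  (λ ()) , LowsDescend-insert e j v (y ∷ ys) E bk av lt

Admissible-insert : ∀ e j v S → Admissible S → All (λ p → v < proj₁ p) S → e < #high S → Admissible (insert e j v S)
Admissible-insert e j v ((g₀ , b₀) ∷ xs) (lt₀ , d , bk) av lt
  with insert-split (g₀ , b₀) xs e j v lt | LowsDescend-insert e j v ((g₀ , b₀) ∷ xs) g₀ bk av lt
... | (g' , b') , rest , pre , post , eq , refl , e1 , e2 | bk' rewrite eq =
  map⁻ {f = proj₁} (subst (All (_< g₀)) (sym e2)
    (All-insert pre v post (subst (All (_< g₀)) e1 (map⁺ lt₀)) (All.head av))) ,
  subst Unique (sym e2)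
    (Unique-insert pre v post (subst Unique e1 d) (subst (All (v ≢_)) e1 (map⁺ (All.map <⇒≢ (All.tail av))))) ,
  bk'

nextValue-removeAfter : ∀ p v zs E → nextValue (removeAfter p v zs) E ≡ proj₁ p
nextValue-removeAfter p v [] E = refl
nextValue-removeAfter p v ((g , b) ∷ ys) E with g ≟ v
... | yes _ = refl
... | no _ = refl

removeAfter-head : ∀ g b v zs → ∃ λ b' → ∃ λ rest → removeAfter (g , b) v zs ≡ (g , b') ∷ rest
removeAfter-head g b v [] = b , [] , refl
removeAfter-head g b v ((g' , b'') ∷ ys) with g' ≟ v
... | yes _ = true , ys , refl
... | no _ = b , removeAfter (g' , b'') v ys , refl

LowsDescend-removeAfter : ∀ x xs v E → LowsDescend (x ∷ xs) E → HighIn v xs → LowsDescend (removeAfter x v xs) E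
LowsDescend-removeAfter x ((gy , by) ∷ ys) v E (_ , (_ , bk)) (inj₁ (refl , refl)) rewrite removeAfter-≡ x gy true gy ys refl =
  (λ ()) , bk
LowsDescend-removeAfter (gx , bx) ((gy , by) ∷ ys) v E (h , bk) (inj₂ (ny , o)) rewrite removeAfter-≢ (gx , bx) gy by v ys ny =
  (λ p → subst (_< gx) (sym (nextValue-removeAfter (gy , by) v ys E)) (h p)) ,
  LowsDescend-removeAfter (gy , by) ys v E bk o

Admissible-removeAfter : ∀ x xs v → Admissible (x ∷ xs) → HighIn v xs → Admissible (removeAfter x v xs)
Admissible-removeAfter (g₀ , b₀) xs v (lt₀ , d , bk) o
  with removeAfter-head g₀ b₀ v xs | removeAfter-split (g₀ , b₀) xs v o | LowsDescend-removeAfter (g₀ , b₀) xs v g₀ bk o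
... | b' , rest , eq | pre , post , e1 , e2 | bk' rewrite eq =
  map⁻ {f = proj₁} (subst (All (_< g₀)) (sym (proj₂ (∷-injective e2)))
    (All-delete pre v post (subst (All (_< g₀)) e1 (map⁺ lt₀)))) ,
  subst Unique (sym (proj₂ (∷-injective e2))) (Unique-delete pre v post (subst Unique e1 d)) ,
  bk'

data Present (v : ℕ) : Marked → Set where
  here : ∀ {b xs} → Present v ((v , b) ∷ xs)
  there : ∀ {x xs} → Present v xs → Present v (x ∷ xs)

Present⇒HighIn : ∀ v xs E → LowsDescend xs E → All (λ p → v ≤ proj₁ p) xs → v < E → Present v xs → HighIn v xs
Present⇒HighIn v ((g , b) ∷ ys) E (h , bk) (vg ∷ av) vE m with g ≟ v
Present⇒HighIn v ((g , true) ∷ ys) E (h , bk) (vg ∷ av) vE m | yes e = inj₁ (e , refl)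
Present⇒HighIn v ((g , false) ∷ ys) E (h , bk) (vg ∷ av) vE m | yes refl = ⊥-elim (<⇒≱ (h refl) (nxt ys av))
  where nxt : ∀ zs → All (λ p → v ≤ proj₁ p) zs → v ≤ nextValue zs E
        nxt [] _ = <⇒≤ vE
        nxt (z ∷ zs) (q ∷ _) = q
Present⇒HighIn v ((g , b) ∷ ys) E (h , bk) (vg ∷ av) vE here | no ne = ⊥-elim (ne refl)
Present⇒HighIn v ((g , b) ∷ ys) E (h , bk) (vg ∷ av) vE (there m) | no ne =
  inj₂ (ne , Present⇒HighIn v ys E bk av vE m)

removeAfter-absent : ∀ p v xs → Absent v xs → removeAfter p v xs ≡ p ∷ xs
removeAfter-absent p v [] _ = refl
removeAfter-absent p v ((g , b) ∷ xs) (g≢v ∷ v∉) =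
  trans (removeAfter-≢ p g b v xs g≢v) (cong (p ∷_) (removeAfter-absent (g , b) v xs v∉))

remove-absent : ∀ v xs → Absent v xs → remove v xs ≡ xs
remove-absent v [] _ = refl
remove-absent v ((g , b) ∷ xs) (g≢v ∷ v∉) = trans (remove-≢ g b v xs g≢v) (removeAfter-absent (g , b) v xs v∉)

All-remove : ∀ {P : ℕ → Set} v X → All (λ p → P (proj₁ p)) X → All (λ p → P (proj₁ p)) (remove v X)
All-remove v [] a = a
All-remove {P} v ((g , b) ∷ xs) (p ∷ a) with g ≟ v
... | yes _ = a
... | no _ = go (g , b) xs p a
  where go : ∀ q zs → P (proj₁ q) → All (λ p → P (proj₁ p)) zs → All (λ p → P (proj₁ p)) (removeAfter q v zs)
        go q [] pq _ = pq ∷ []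
        go q ((g' , b') ∷ zs) pq (p' ∷ a') with g' ≟ v
        ... | yes _ = pq ∷ a'
        ... | no _ = pq ∷ go (g' , b') zs p' a'

unique⇒absent : ∀ {v} zs → All (λ y → v ≢ y) (values zs) → Absent v zs
unique⇒absent zs v∉ = map⁻ (All.map ≢-sym v∉)

absent-removeAfter : ∀ p v xs → proj₁ p ≢ v → Unique (values xs) → Absent v (removeAfter p v xs)
absent-removeAfter p v [] ne _ = ne ∷ []
absent-removeAfter p v ((g , b) ∷ ys) ne (a ∷ d) with g ≟ v
... | yes refl = ne ∷ unique⇒absent ys a
... | no n = ne ∷ absent-removeAfter (g , b) v ys n d

Admissible⇒unique : ∀ X → Admissible X → Unique (values X)
Admissible⇒unique [] _ = []
Admissible⇒unique ((g , b) ∷ xs) (lt , d , _) = map⁺ (All.map >⇒≢ lt) ∷ d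

absent-remove : ∀ v X → Admissible X → Absent v (remove v X)
absent-remove v [] _ = []
absent-remove v ((g , b) ∷ xs) bv with g ≟ v | Admissible⇒unique ((g , b) ∷ xs) bv
... | yes refl | (a ∷ _) = unique⇒absent xs a
... | no n | (_ ∷ d) = absent-removeAfter (g , b) v xs n d

present? : ∀ v X → Present v X ⊎ Absent v X
present? v [] = inj₂ []
present? v ((g , b) ∷ xs) with g ≟ v
... | yes refl = inj₁ here
... | no n with present? v xs
... | inj₁ m = inj₁ (there m)
... | inj₂ a = inj₂ (n ∷ a)

All<∧All≥⇒[] : ∀ {m} (xs : Marked) → All (λ p → proj₁ p < m) xs → All (λ p → m ≤ proj₁ p) xs → xs ≡ []
All<∧All≥⇒[] [] _ _ = refl
All<∧All≥⇒[] (x ∷ xs) (x< ∷ _) (≤x ∷ _) = ⊥-elim (<⇒≱ x< ≤x)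

Admissible-remove-min : ∀ v X → Admissible X → All (λ p → v ≤ proj₁ p) X → Admissible (remove v X)
Admissible-remove-min v [] _ _ = tt
Admissible-remove-min v ((g , b) ∷ xs) bv@(lt , d , bk) (vg ∷ av) with g ≟ v
... | yes refl = subst Admissible (sym (All<∧All≥⇒[] xs lt av)) tt
... | no n with present? v xs
... | inj₁ m = Admissible-removeAfter (g , b) xs v bv (Present⇒HighIn v xs g (proj₂ bk) av (≤∧≢⇒< vg (≢-sym n)) m)
... | inj₂ a = subst Admissible (sym (removeAfter-absent (g , b) v xs a)) bv

removeBelow : ℕ → Marked → Marked
removeBelow zero S = S
removeBelow (suc v) S = remove v (removeBelow v S)

absent⇒< : ∀ v X → All (λ p → v ≤ proj₁ p) X → Absent v X → All (λ p → suc v ≤ proj₁ p) X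
absent⇒< v [] _ _ = []
absent⇒< v (x ∷ xs) (p ∷ a) (n ∷ ns) = ≤∧≢⇒< p (λ e → n (sym e)) ∷ absent⇒< v xs a ns

removeBelow-admissible : ∀ T → Admissible T → ∀ v →
  Admissible (removeBelow v T) × All (λ p → v ≤ proj₁ p) (removeBelow v T)
removeBelow-admissible T bv zero = bv , All.universal (λ _ → z≤n) T
removeBelow-admissible T bv (suc v) with removeBelow-admissible T bv v
... | bv' , av =
  Admissible-remove-min v (removeBelow v T) bv' av ,
  absent⇒< v (remove v (removeBelow v T)) (All-remove v (removeBelow v T) av) (absent-remove v (removeBelow v T) bv')

All-removeBelow : ∀ {P : ℕ → Set} T v → All (λ p → P (proj₁ p)) T → All (λ p → P (proj₁ p)) (removeBelow v T)
All-removeBelow T zero a = a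
All-removeBelow T (suc v) a = All-remove v (removeBelow v T) (All-removeBelow T v a)




#high-insert-new : ∀ x xs e v → e < #high (x ∷ xs) → #high (insert e false v (x ∷ xs)) ≡ suc (#high (x ∷ xs))
#high-insert-new (g , false) (y ∷ ys) e v lt = #high-insert-new y ys e v lt
#high-insert-new (g , true) xs zero v lt = refl
#high-insert-new (g , true) (y ∷ ys) (suc e) v (s≤s lt) = cong suc (#high-insert-new y ys e v lt)

#high-insert-join : ∀ x xs e v → e < #high (x ∷ xs) → #high (insert e true v (x ∷ xs)) ≡ #high (x ∷ xs)
#high-insert-join (g , false) (y ∷ ys) e v lt = #high-insert-join y ys e v lt
#high-insert-join (g , true) xs zero v lt = refl
#high-insert-join (g , true) (y ∷ ys) (suc e) v (s≤s lt) = cong suc (#high-insert-join y ys e v lt)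

LowsDescend⇒0<#high : ∀ x xs E → LowsDescend (x ∷ xs) E → All (λ p → proj₁ p ≤ E) (x ∷ xs) → 0 < #high (x ∷ xs)
LowsDescend⇒0<#high (g , true) xs E _ _ = s≤s z≤n
LowsDescend⇒0<#high (g , false) [] E (h , _) (le ∷ _) = ⊥-elim (<⇒≱ (h refl) le)
LowsDescend⇒0<#high (g , false) (y ∷ ys) E (_ , bk) (_ ∷ a) = LowsDescend⇒0<#high y ys E bk a

0<#high : ∀ x xs → Admissible (x ∷ xs) → 0 < #high (x ∷ xs)
0<#high (g₀ , b₀) xs (lt , _ , bk) = LowsDescend⇒0<#high (g₀ , b₀) xs g₀ bk (≤-refl ∷ All.map <⇒≤ lt)

insert-present : ∀ e j v S → Present v (insert e j v S)
insert-present e j v [] = here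
insert-present e j v ((g , false) ∷ xs) = there (insert-present e j v xs)
insert-present zero j v ((g , true) ∷ xs) = there here
insert-present (suc e) j v ((g , true) ∷ xs) = there (insert-present e j v xs)

absent⇒¬present : ∀ {v X} → Absent v X → Present v X → ⊥
absent⇒¬present (n ∷ _) here = n refl
absent⇒¬present (_ ∷ ns) (there m) = absent⇒¬present ns m

-- the number of beats from ready g to the next ready state ready g'
beats : ℕ → Bool → ℕ → ℕ
beats g true _ = suc g
beats g false g' = g ∸ g'

toBlocks : ℕ → Marked → Blocks
toBlocks E [] = []
toBlocks E ((g , b) ∷ xs) = (g , beats g b (nextValue xs E)) ∷ toBlocks E xs

period-insert : ∀ E x xs e j v → e < #high (x ∷ xs) → All (λ p → v < proj₁ p) (x ∷ xs) →
          period (toBlocks E (insert e j v (x ∷ xs))) ≡ (if j then 0 else suc v) + period (toBlocks E (x ∷ xs))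
period-insert E (g , false) (y ∷ ys) e j v lt (_ ∷ av) =
  trans (cong (λ z → beats g false z + period (toBlocks E (insert e j v (y ∷ ys)))) (nextValue-insert e j v y ys lt E))
        (trans (cong (beats g false (proj₁ y) +_) (period-insert E y ys e j v lt av))
               (x∙yz≈y∙xz (beats g false (proj₁ y)) (if j then 0 else suc v) (period (toBlocks E (y ∷ ys)))))
period-insert E (g , true) xs zero false v lt _ = x∙yz≈y∙xz (suc g) (suc v) _
period-insert E (g , true) xs zero true v lt (vg ∷ _) =
  trans (sym (+-assoc (g ∸ v) (suc v) _))
        (cong (_+ period (toBlocks E xs)) (trans (+-suc (g ∸ v) v) (cong suc (m∸n+n≡m (<⇒≤ vg)))))
period-insert E (g , true) (y ∷ ys) (suc e) j v (s≤s lt) (_ ∷ av) =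
  trans (cong (suc g +_) (period-insert E y ys e j v lt av))
        (x∙yz≈y∙xz (suc g) (if j then 0 else suc v) (period (toBlocks E (y ∷ ys))))

headValue : Marked → ℕ
headValue [] = 0
headValue ((g , _) ∷ _) = g

markedPeriod : Marked → ℕ
markedPeriod S = period (toBlocks (headValue S) S)

headValue-insert : ∀ x xs e j v → e < #high (x ∷ xs) → headValue (insert e j v (x ∷ xs)) ≡ proj₁ x
headValue-insert x xs e j v lt with insert-split x xs e j v lt
... | x' , rest , _ , _ , eq , h , _ = trans (cong headValue eq) h

markedPeriod-insert : ∀ x xs e j v → e < #high (x ∷ xs) → All (λ p → v < proj₁ p) (x ∷ xs) →
           markedPeriod (insert e j v (x ∷ xs)) ≡ (if j then 0 else suc v) + markedPeriod (x ∷ xs)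
markedPeriod-insert x xs e j v lt av =
  trans (cong (λ z → period (toBlocks z (insert e j v (x ∷ xs)))) (headValue-insert x xs e j v lt))
        (period-insert (proj₁ x) x xs e j v lt av)

values-toBlocks : ∀ E xs → map proj₁ (toBlocks E xs) ≡ values xs
values-toBlocks E [] = refl
values-toBlocks E ((g , b) ∷ xs) = cong (g ∷_) (values-toBlocks E xs)

nextReady-toBlocks : ∀ E xs → nextReady (toBlocks E xs) E ≡ nextValue xs E
nextReady-toBlocks E [] = refl
nextReady-toBlocks E ((g , b) ∷ xs) = refl

toBlocks-linked : ∀ E xs → LowsDescend xs E → Linked (toBlocks E xs) E
toBlocks-linked E [] _ = tt
toBlocks-linked E ((g , true) ∷ xs) (_ , bk) =
  subst (Link g (suc g)) (sym (nextReady-toBlocks E xs)) (inj₁ refl) , toBlocks-linked E xs bk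
toBlocks-linked E ((g , false) ∷ xs) (h , bk) =
  subst (Link g (g ∸ nextValue xs E)) (sym (nextReady-toBlocks E xs)) (inj₂ (m<n⇒0<n∸m (h refl) , m∸n+n≡m (<⇒≤ (h refl)))) ,
  toBlocks-linked E xs bk

All-toBlocks : ∀ {P : ℕ → Set} E xs → All (λ p → P (proj₁ p)) xs → All (λ p → P (proj₁ p)) (toBlocks E xs)
All-toBlocks E [] [] = []
All-toBlocks E ((g , b) ∷ xs) (p ∷ a) = p ∷ All-toBlocks E xs a

toBlocks-canonical : ∀ g₀ b₀ xs → Admissible ((g₀ , b₀) ∷ xs) → CanonicalBlocks (toBlocks g₀ ((g₀ , b₀) ∷ xs))
toBlocks-canonical g₀ b₀ xs (lt , d , bk) =
  All-toBlocks g₀ xs lt , subst Unique (sym (values-toBlocks g₀ xs)) d , toBlocks-linked g₀ ((g₀ , b₀) ∷ xs) bk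

fromBlocks : Blocks → Marked
fromBlocks = map (λ p → (proj₁ p , (proj₂ p ≡ᵇ suc (proj₁ p))))

≡ᵇ-refl : ∀ n → (n ≡ᵇ n) ≡ true
≡ᵇ-refl zero = refl
≡ᵇ-refl (suc n) = ≡ᵇ-refl n

<⇒≡ᵇ≡false : ∀ c n → c < n → (c ≡ᵇ n) ≡ false
<⇒≡ᵇ≡false zero (suc n) _ = refl
<⇒≡ᵇ≡false (suc c) (suc n) (s≤s l) = <⇒≡ᵇ≡false c n l

throw-link : ∀ g c g' → Link g c g' → beats g (c ≡ᵇ suc g) g' ≡ c
throw-link g c g' (inj₁ refl) rewrite ≡ᵇ-refl g = refl
throw-link g c g' (inj₂ (p , e)) rewrite <⇒≡ᵇ≡false c (suc g) (s≤s (subst (c ≤_) e (m≤m+n c g'))) =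
  trans (cong (_∸ g') (sym e)) (m+n∸n≡m c g')

link-low : ∀ g c g' → Link g c g' → (c ≡ᵇ suc g) ≡ false → g' < g
link-low g c g' (inj₁ refl) f rewrite ≡ᵇ-refl g with f
... | ()
link-low g c g' (inj₂ (p , e)) f = subst (g' <_) e (+-monoˡ-≤ g' p)

nextValue-fromBlocks : ∀ E ps → nextValue (fromBlocks ps) E ≡ nextReady ps E
nextValue-fromBlocks E [] = refl
nextValue-fromBlocks E (p ∷ ps) = refl

toBlocks-fromBlocks : ∀ E ps → Linked ps E → toBlocks E (fromBlocks ps) ≡ ps
toBlocks-fromBlocks E [] _ = refl
toBlocks-fromBlocks E ((g , c) ∷ ps) (ok , pok) =
  cong₂ _∷_ (cong (g ,_) (trans (cong (beats g (c ≡ᵇ suc g)) (nextValue-fromBlocks E ps)) (throw-link g c _ ok)))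
            (toBlocks-fromBlocks E ps pok)

fromBlocks-lowsDescend : ∀ E ps → Linked ps E → LowsDescend (fromBlocks ps) E
fromBlocks-lowsDescend E [] _ = tt
fromBlocks-lowsDescend E ((g , c) ∷ ps) (ok , pok) =
  (λ f → subst (_< g) (sym (nextValue-fromBlocks E ps)) (link-low g c _ ok f)) , fromBlocks-lowsDescend E ps pok

values-fromBlocks : ∀ ps → values (fromBlocks ps) ≡ map proj₁ ps
values-fromBlocks [] = refl
values-fromBlocks (p ∷ ps) = cong (proj₁ p ∷_) (values-fromBlocks ps)

All-fromBlocks : ∀ {P : ℕ → Set} (ps : Blocks) → All (λ p → P (proj₁ p)) ps →
                 All (λ p → P (proj₁ p)) (fromBlocks ps)
All-fromBlocks [] [] = []
All-fromBlocks (p ∷ ps) (q ∷ a) = q ∷ All-fromBlocks ps a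

fromBlocks-admissible : ∀ g₀ c₀ ps → CanonicalBlocks ((g₀ , c₀) ∷ ps) → Admissible (fromBlocks ((g₀ , c₀) ∷ ps))
fromBlocks-admissible g₀ c₀ ps (lt , d , pok) =
  All-fromBlocks ps lt , subst Unique (sym (values-fromBlocks ps)) d , fromBlocks-lowsDescend g₀ ((g₀ , c₀) ∷ ps) pok

fromBlocks-toBlocks : ∀ E xs → fromBlocks (toBlocks E xs) ≡ xs
fromBlocks-toBlocks E [] = refl
fromBlocks-toBlocks E ((g , true) ∷ xs) = cong₂ _∷_ (cong (g ,_) (≡ᵇ-refl g)) (fromBlocks-toBlocks E xs)
fromBlocks-toBlocks E ((g , false) ∷ xs) =
  cong₂ _∷_ (cong (g ,_) (<⇒≡ᵇ≡false (g ∸ nextValue xs E) (suc g) (s≤s (m∸n≤m g (nextValue xs E)))))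
            (fromBlocks-toBlocks E xs)

-- the last entry before returning to E is high, so the period exceeds the first value
head<period : ∀ E g b xs → LowsDescend ((g , b) ∷ xs) E → All (λ p → proj₁ p ≤ E) ((g , b) ∷ xs) →
              g < period (toBlocks E ((g , b) ∷ xs))
head<period E g true xs _ _ = m≤m+n (suc g) _
head<period E g false [] (next<g , _) (g≤E ∷ _) = ⊥-elim (<⇒≱ (next<g refl) g≤E)
head<period E g false ((g' , b') ∷ xs) (g'<g , ld) (_ ∷ ≤E) = begin-strict
  g                                      ≡⟨ m∸n+n≡m (<⇒≤ (g'<g refl)) ⟨
  (g ∸ g') + g'                          <⟨ +-monoʳ-< (g ∸ g') (head<period E g' b' xs ld ≤E) ⟩
  (g ∸ g') + period (toBlocks E ((g' , b') ∷ xs)) ∎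
  where open ≤-Reasoning

head<markedPeriod : ∀ g b xs → Admissible ((g , b) ∷ xs) → g < markedPeriod ((g , b) ∷ xs)
head<markedPeriod g b xs (below , _ , ld) = head<period g g b xs ld (≤-refl ∷ All.map <⇒≤ below)



-- Codes

-- a new high entry can go after any of the i high entries, or first into the empty list
slots : ℕ → ℕ
slots zero = 1
slots (suc i) = suc i

-- The choices for v ∸ 1, …, 0 (in this order) that complete a marked list with
-- i high entries and period σ, all of whose values are ≥ v, to one of period n:
-- each value is absent, joined after a high entry, or a new high entry.
data Code (n : ℕ) : ℕ → ℕ → ℕ → Set where
  end  : ∀ {i} → Code n 0 i n
  skip : ∀ {v i σ} → Code n v i σ → Code n (suc v) i σ
  join : ∀ {v i σ} → Fin i → Code n v i σ → Code n (suc v) i σ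
  new  : ∀ {v i σ} → Fin (slots i) → Code n v (suc i) (suc v + σ) → Code n (suc v) i σ

build : ∀ {n v i σ} → Code n v i σ → Marked → Marked
build end S = S
build (skip c) S = build c S
build {v = suc v} (join e c) S = build c (insert (toℕ e) true v S)
build {v = suc v} (new e c) S = build c (insert (toℕ e) false v S)

step : ∀ {n v i σ} → Code n (suc v) i σ → Marked → Marked
step (skip c) S = S
step {v = v} (join e c) S = insert (toℕ e) true v S
step {v = v} (new e c) S = insert (toℕ e) false v S

Code-tail : ∀ {n v i σ} → Code n (suc v) i σ → ∃₂ λ i' σ' → Code n v i' σ'
Code-tail (skip c) = _ , _ , c
Code-tail (join e c) = _ , _ , c
Code-tail (new e c) = _ , _ , c

build-step : ∀ {n v i σ} (c : Code n (suc v) i σ) S → build c S ≡ build (proj₂ (proj₂ (Code-tail c))) (step c S)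
build-step (skip c) S = refl
build-step (join e c) S = refl
build-step (new e c) S = refl

headMark : ∀ {n v i σ} → Code n (suc v) i σ → Maybe (ℕ × Bool)
headMark (skip c) = nothing
headMark (join e c) = just (toℕ e , true)
headMark (new e c) = just (toℕ e , false)

Partial : ℕ → ℕ → Marked → Set
Partial v i S = Admissible S × All (λ p → v ≤ proj₁ p) S × #high S ≡ i

partial-weaken : ∀ {v i S} → Partial (suc v) i S → Partial v i S
partial-weaken (a , v≤ , #h) = a , All.map <⇒≤ v≤ , #h

partial-absent : ∀ {v i S} → Partial (suc v) i S → Absent v S
partial-absent (_ , v< , _) = All.map >⇒≢ v<

data Slot (S : Marked) (e : ℕ) : Set where
  slot-empty : S ≡ [] → e ≡ 0 → Slot S e
  slot-cons  : ∀ x xs → S ≡ x ∷ xs → e < #high S → Slot S e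

joinSlot : ∀ {i} S → #high S ≡ i → (e : Fin i) → ∃₂ λ x xs → S ≡ x ∷ xs × toℕ e < #high S
joinSlot (x ∷ xs) refl e = x , xs , refl , toℕ<n e

newSlot : ∀ {i} S → Admissible S → #high S ≡ i → (e : Fin (slots i)) → Slot S (toℕ e)
newSlot [] _ refl zero = slot-empty refl refl
newSlot (x ∷ xs) a refl e = slot-cons x xs refl (subst (toℕ e <_) (slots-pos (0<#high x xs a)) (toℕ<n e))
  where
  slots-pos : ∀ {i} → 0 < i → slots i ≡ i
  slots-pos {suc i} _ = refl

All-values-insert : ∀ {P : ℕ → Set} e j v S → All (λ p → P (proj₁ p)) S → P v →
              All (λ p → P (proj₁ p)) (insert e j v S)
All-values-insert e j v [] a pv = pv ∷ []
All-values-insert e j v ((g , false) ∷ xs) (p ∷ a) pv = p ∷ All-values-insert e j v xs a pv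
All-values-insert zero j v ((g , true) ∷ xs) (p ∷ a) pv = p ∷ pv ∷ a
All-values-insert (suc e) j v ((g , true) ∷ xs) (p ∷ a) pv = p ∷ All-values-insert e j v xs a pv

admissible-single : ∀ v → Admissible ((v , true) ∷ [])
admissible-single v = [] , [] , (λ ()) , tt

partial-insert : ∀ v i e j S → Partial (suc v) i S → Slot S e →
                 Admissible (insert e j v S) × All (λ p → v ≤ proj₁ p) (insert e j v S)
partial-insert v i e j S _ (slot-empty refl refl) = admissible-single v , ≤-refl ∷ []
partial-insert v i e j S (a , v< , _) (slot-cons x xs refl lt) =
  Admissible-insert e j v (x ∷ xs) a v< lt , All-values-insert e j v (x ∷ xs) (All.map <⇒≤ v<) ≤-refl

partial-join : ∀ v i e x xs → Partial (suc v) i (x ∷ xs) → e < #high (x ∷ xs) → Partial v i (insert e true v (x ∷ xs))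
partial-join v i e x xs p lt =
  let a , v≤ = partial-insert v i e true (x ∷ xs) p (slot-cons x xs refl lt)
  in a , v≤ , trans (#high-insert-join x xs e v lt) (proj₂ (proj₂ p))

partial-new : ∀ v i e S → Partial (suc v) i S → Slot S e → Partial v (suc i) (insert e false v S)
partial-new v i e S p (slot-empty refl refl) = admissible-single v , ≤-refl ∷ [] , cong suc (proj₂ (proj₂ p))
partial-new v i e S p s@(slot-cons x xs refl lt) =
  let a , v≤ = partial-insert v i e false S p s
  in a , v≤ , trans (#high-insert-new x xs e v lt) (cong suc (proj₂ (proj₂ p)))

partial-step : ∀ {n v i σ} (c : Code n (suc v) i σ) {S} → Partial (suc v) i S →
  Partial v (proj₁ (Code-tail c)) (step c S)
partial-step (skip c) p = partial-weaken p
partial-step {v = v} {i} (join e c) {S} p with joinSlot S (proj₂ (proj₂ p)) e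
... | x , xs , refl , lt = partial-join v i (toℕ e) x xs p lt
partial-step {v = v} {i} (new e c) {S} p = partial-new v i (toℕ e) S p (newSlot S (proj₁ p) (proj₂ (proj₂ p)) e)

remove-step : ∀ {n v i σ} (c : Code n (suc v) i σ) {S} → Partial (suc v) i S → remove v (step c S) ≡ S
remove-step {v = v} (skip c) {S} p = remove-absent v S (partial-absent p)
remove-step {v = v} (join e c) {S} p with joinSlot S (proj₂ (proj₂ p)) e
... | x , xs , refl , lt = remove-insert x xs (toℕ e) true v lt (partial-absent p)
remove-step {v = v} (new e c) {S} p with newSlot S (proj₁ p) (proj₂ (proj₂ p)) e
... | slot-empty refl e≡0 = remove-≡ v true v [] refl
... | slot-cons x xs refl lt = remove-insert x xs (toℕ e) false v lt (partial-absent p)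

removeBelow-build : ∀ {n v i σ} (c : Code n v i σ) S → Partial v i S → removeBelow v (build c S) ≡ S
removeBelow-build end S p = refl
removeBelow-build {v = suc v} c S p = begin
  remove v (removeBelow v (build c S))
    ≡⟨ cong (remove v ∘ removeBelow v) (build-step c S) ⟩
  remove v (removeBelow v (build (proj₂ (proj₂ (Code-tail c))) (step c S)))
    ≡⟨ cong (remove v) (removeBelow-build (proj₂ (proj₂ (Code-tail c))) (step c S) (partial-step c p)) ⟩
  remove v (step c S)
    ≡⟨ remove-step c p ⟩
  S ∎
  where open ≡-Reasoning

observe : ℕ → Marked → Maybe (ℕ × Bool)
observe v S with present? v S
... | inj₁ _ = just (position v S)
... | inj₂ _ = nothing

observe-present : ∀ {v S} → Present v S → observe v S ≡ just (position v S)
observe-present {v} {S} v∈ with present? v S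
... | inj₁ _ = refl
... | inj₂ v∉ = ⊥-elim (absent⇒¬present v∉ v∈)

observe-absent : ∀ {v S} → Absent v S → observe v S ≡ nothing
observe-absent {v} {S} v∉ with present? v S
... | inj₁ v∈ = ⊥-elim (absent⇒¬present v∉ v∈)
... | inj₂ _ = refl

position-insert-new : ∀ v S e → Slot S e → Absent v S → position v (insert e false v S) ≡ (e , false)
position-insert-new v S e (slot-empty refl refl) _ = refl
position-insert-new v S e (slot-cons x xs refl lt) v∉ = position-insert x xs e false v lt v∉

observe-step : ∀ {n v i σ} (c : Code n (suc v) i σ) {S} → Partial (suc v) i S → observe v (step c S) ≡ headMark c
observe-step (skip c) p = observe-absent (partial-absent p)
observe-step {v = v} (join e c) {S} p with joinSlot S (proj₂ (proj₂ p)) e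
... | x , xs , refl , lt = trans (observe-present (insert-present (toℕ e) true v S))
                                 (cong just (position-insert x xs (toℕ e) true v lt (partial-absent p)))
observe-step {v = v} (new e c) {S} p = trans (observe-present (insert-present (toℕ e) false v S))
  (cong just (position-insert-new v S (toℕ e) (newSlot S (proj₁ p) (proj₂ (proj₂ p)) e) (partial-absent p)))

build-start-injective : ∀ {n v i i' σ σ'} (c : Code n v i σ) (c' : Code n v i' σ') S S' →
                        Partial v i S → Partial v i' S' → build c S ≡ build c' S' → S ≡ S'
build-start-injective {v = v} c c' S S' p p' eq =
  trans (sym (removeBelow-build c S p)) (trans (cong (removeBelow v) eq) (removeBelow-build c' S' p'))

-- the first step, hence the first choice, can be read off the result
headMark-injective : ∀ {n v i σ} (c c' : Code n (suc v) i σ) S → Partial (suc v) i S → build c S ≡ build c' S →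
                     headMark c ≡ headMark c'
headMark-injective {v = v} c c' S p eq = begin
  headMark c           ≡⟨ observe-step c p ⟨
  observe v (step c S)  ≡⟨ cong (observe v) (build-start-injective (proj₂ (proj₂ (Code-tail c))) (proj₂ (proj₂ (Code-tail c')))
                                               _ _ (partial-step c p) (partial-step c' p) eq′) ⟩
  observe v (step c' S) ≡⟨ observe-step c' p ⟩
  headMark c'          ∎
  where
  open ≡-Reasoning
  eq′ : build (proj₂ (proj₂ (Code-tail c))) (step c S) ≡ build (proj₂ (proj₂ (Code-tail c'))) (step c' S)
  eq′ = trans (sym (build-step c S)) (trans eq (build-step c' S))

build-injective : ∀ {n v i σ} (c c' : Code n v i σ) S → Partial v i S → build c S ≡ build c' S → c ≡ c'
build-injective end end S p eq = refl
build-injective {v = suc v} c c' S p eq with headMark-injective c c' S p eq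
build-injective (skip c) (skip c') S p eq | _ = cong skip (build-injective c c' S (partial-step (skip c) p) eq)
build-injective (join e c) (join e' c') S p eq | m≡ with toℕ-injective (cong proj₁ (just-injective m≡))
... | refl = cong (join e) (build-injective c c' _ (partial-step (join e c) p) eq)
build-injective (new e c) (new e' c') S p eq | m≡ with toℕ-injective (cong proj₁ (just-injective m≡))
... | refl = cong (new e) (build-injective c c' _ (partial-step (new e c) p) eq)
build-injective (skip _) (join _ _) S p eq | ()
build-injective (skip _) (new _ _) S p eq | ()
build-injective (join _ _) (skip _) S p eq | ()
build-injective (join _ _) (new _ _) S p eq | ()
build-injective (new _ _) (skip _) S p eq | ()
build-injective (new _ _) (join _ _) S p eq | ()
build-admissible : ∀ {n v i σ} (c : Code n v i σ) S → Partial v i S → markedPeriod S ≡ σ →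
                   Admissible (build c S) × markedPeriod (build c S) ≡ n
build-admissible end S p per = proj₁ p , per
build-admissible {v = suc v} (skip c) S p per = build-admissible c S (partial-weaken p) per
build-admissible {v = suc v} {i} (join e c) S p per with joinSlot S (proj₂ (proj₂ p)) e
... | x , xs , refl , lt = build-admissible c _ (partial-join v i (toℕ e) x xs p lt)
                             (trans (markedPeriod-insert x xs (toℕ e) true v lt (proj₁ (proj₂ p))) per)
build-admissible {v = suc v} {i} (new e c) S p per with newSlot S (proj₁ p) (proj₂ (proj₂ p)) e
... | s@(slot-empty refl e≡0) = build-admissible c _ (partial-new v i (toℕ e) S p s)
                                   (subst (λ z → markedPeriod (insert z false v []) ≡ suc v + _) (sym e≡0)
                                          (cong (suc v +_) per))
... | s@(slot-cons x xs refl lt) = build-admissible c _ (partial-new v i (toℕ e) S p s)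
                                     (trans (markedPeriod-insert x xs (toℕ e) false v lt (proj₁ (proj₂ p)))
                                            (cong (suc v +_) per))

data MinView (v : ℕ) (S : Marked) : Set where
  minAbsent   : remove v S ≡ S → MinView v S
  minInserted : ∀ e j → S ≡ insert e j v (remove v S) → Slot (remove v S) e →
                (j ≡ true → ∃₂ λ x xs → remove v S ≡ x ∷ xs) → MinView v S

minView : ∀ v S → Admissible S → All (λ p → v ≤ proj₁ p) S → MinView v S
minView v S a v≤ with present? v S
... | inj₂ v∉ = minAbsent (remove-absent v S v∉)
minView v ((g₀ , b₀) ∷ xs) (below , _ , ld) (v≤g₀ ∷ v≤) | inj₁ v∈ with g₀ ≟ v
... | yes refl = only b₀ xs below v≤ (proj₁ ld)
  where
  only : ∀ b xs → All (λ p → proj₁ p < g₀) xs → All (λ p → g₀ ≤ proj₁ p) xs →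
         (b ≡ false → nextValue xs g₀ < g₀) → MinView g₀ ((g₀ , b) ∷ xs)
  only true [] _ _ _ = minInserted 0 false (sym (cong (insert 0 false g₀) removed)) (slot-empty removed refl) (λ ())
    where
    removed : remove g₀ ((g₀ , true) ∷ []) ≡ []
    removed = remove-≡ g₀ true g₀ [] refl
  only false [] _ _ low = ⊥-elim (<-irrefl refl (low refl))
  only b (_ ∷ _) (x<g₀ ∷ _) (g₀≤x ∷ _) _ = ⊥-elim (<⇒≱ x<g₀ g₀≤x)
minView v ((g₀ , b₀) ∷ xs) (below , _ , ld) (v≤g₀ ∷ v≤) | inj₁ here | no g₀≢v = ⊥-elim (g₀≢v refl)
minView v ((g₀ , b₀) ∷ xs) (below , _ , ld) (v≤g₀ ∷ v≤) | inj₁ (there v∈) | no g₀≢v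
  with removeAfter-inverse (g₀ , b₀) xs v
         (Present⇒HighIn v xs g₀ (proj₂ ld) v≤ (≤∧≢⇒< v≤g₀ (≢-sym g₀≢v)) v∈)
     | removeAfter-head g₀ b₀ v xs
... | e , j , ins≡ , e< | b' , rest , rem≡ =
  minInserted e j (sym (trans (cong (insert e j v) r≡) ins≡))
    (slot-cons (g₀ , b') rest (trans r≡ rem≡) (subst (λ z → e < #high z) (sym r≡) e<))
    (λ _ → (g₀ , b') , rest , trans r≡ rem≡)
  where
  r≡ : remove v ((g₀ , b₀) ∷ xs) ≡ removeAfter (g₀ , b₀) v xs
  r≡ = remove-≢ g₀ b₀ v xs g₀≢v

#high-new : ∀ v S e → Slot S e → #high (insert e false v S) ≡ suc (#high S)
#high-new v S e (slot-empty refl refl) = refl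
#high-new v S e (slot-cons x xs refl lt) = #high-insert-new x xs e v lt

markedPeriod-new : ∀ v S e → Slot S e → All (λ p → v < proj₁ p) S →
  markedPeriod (insert e false v S) ≡ suc v + markedPeriod S
markedPeriod-new v S e (slot-empty refl refl) _ = refl
markedPeriod-new v S e (slot-cons x xs refl lt) av = markedPeriod-insert x xs e false v lt av

newSlot⁻¹ : ∀ S e i → Slot S e → #high S ≡ i → Σ (Fin (slots i)) (λ f → toℕ f ≡ e)
newSlot⁻¹ S e i (slot-empty refl refl) refl = zero , refl
newSlot⁻¹ S e zero (slot-cons x xs refl lt) eq with subst (e <_) eq lt
... | ()
newSlot⁻¹ S e (suc i) (slot-cons x xs refl lt) eq = fromℕ< (subst (e <_) eq lt) , toℕ-fromℕ< (subst (e <_) eq lt)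

join-invariants : ∀ v S e → Slot S e → (∃ λ x → ∃ λ xs → S ≡ x ∷ xs) → All (λ p → v < proj₁ p) S →
  e < #high S × #high (insert e true v S) ≡ #high S × markedPeriod (insert e true v S) ≡ markedPeriod S
join-invariants v S e (slot-empty refl refl) (x , xs , ()) av
join-invariants v S e (slot-cons x xs refl lt) _ av =
  lt , #high-insert-join x xs e v lt , markedPeriod-insert x xs e true v lt av

build-surjective : ∀ n v i σ T → Admissible T → #high (removeBelow v T) ≡ i → markedPeriod (removeBelow v T) ≡ σ →
                   markedPeriod T ≡ n → ∃ λ (c : Code n v i σ) → build c (removeBelow v T) ≡ T
build-surjective n zero i σ T a #h per per-n with trans (sym per-n) per
... | refl = end , refl
build-surjective n (suc v) i σ T a #h per per-n
  with minView v (removeBelow v T) (proj₁ (removeBelow-admissible T a v)) (proj₂ (removeBelow-admissible T a v))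
... | minAbsent eq
  with build-surjective n v i σ T a (trans (cong #high (sym eq)) #h) (trans (cong markedPeriod (sym eq)) per) per-n
... | c , built = skip c , trans (cong (build c) eq) built
build-surjective n (suc v) i σ T a #h per per-n | minInserted e true eq s nonempty
  with join-invariants v (removeBelow (suc v) T) e s (nonempty refl) (proj₂ (removeBelow-admissible T a (suc v)))
... | e< , #h≡ , per≡
  with build-surjective n v i σ T a (trans (cong #high eq) (trans #h≡ #h)) (trans (cong markedPeriod eq) (trans per≡ per)) per-n
... | c , built = join (fromℕ< e<i) c ,
  trans (cong (λ z → build c (insert z true v (removeBelow (suc v) T))) (toℕ-fromℕ< e<i)) (trans (cong (build c) (sym eq)) built)
  where
  e<i : e < i
  e<i = subst (e <_) #h e<
build-surjective n (suc v) i σ T a #h per per-n | minInserted e false eq s _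
  with newSlot⁻¹ (removeBelow (suc v) T) e i s #h
... | f , f≡e
  with build-surjective n v (suc i) (suc v + σ) T a (trans (cong #high eq) (trans (#high-new v _ e s) (cong suc #h)))
         (trans (cong markedPeriod eq) (trans (markedPeriod-new v _ e s (proj₂ (removeBelow-admissible T a (suc v)))) (cong (suc v +_) per)))
         per-n
... | c , built = new f c ,
  trans (cong (λ z → build c (insert z false v (removeBelow (suc v) T))) f≡e) (trans (cong (build c) (sym eq)) built)



-- Cycles and codes

statesOf : Marked → List State
statesOf T = expand (toBlocks (headValue T) T) (headValue T)

cycleOfMarked : ∀ n (T : Marked) → Admissible T → markedPeriod T ≡ suc n → Cycle (suc n)
cycleOfMarked n ((g₀ , b₀) ∷ xs) a p = cycleFrom n states (trans length-states p) states-path states-unique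
  where open Expansion g₀ (beats g₀ b₀ (nextValue xs g₀)) (toBlocks g₀ xs) (toBlocks-canonical g₀ b₀ xs a)

cycleOfMarked-v : ∀ n T a p k → v (cycleOfMarked n T a p) k ≡ at (statesOf T) (k % suc n)
cycleOfMarked-v n ((g₀ , b₀) ∷ xs) a p k = refl

cycleOfMarked-injective : ∀ n T T' a a' p p' → cycleOfMarked n T a p ≈c cycleOfMarked n T' a' p' → T ≡ T'
cycleOfMarked-injective n T@((g₀ , b₀) ∷ xs) T'@((g₁ , b₁) ∷ ys) a a' p p' C≈C' = begin
  T                         ≡⟨ fromBlocks-toBlocks g₀ T ⟨
  fromBlocks (toBlocks g₀ T)  ≡⟨ cong fromBlocks (expand-injective _ _ g₀ g₁ (proj₂ (proj₂ (toBlocks-canonical g₀ b₀ xs a)))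
                                                   (proj₂ (proj₂ (toBlocks-canonical g₁ b₁ ys a'))) states≡) ⟩
  fromBlocks (toBlocks g₁ T') ≡⟨ fromBlocks-toBlocks g₁ T' ⟩
  T'                        ∎
  where
  open ≡-Reasoning
  module X = Expansion g₀ (beats g₀ b₀ (nextValue xs g₀)) (toBlocks g₀ xs) (toBlocks-canonical g₀ b₀ xs a)
  module Y = Expansion g₁ (beats g₁ b₁ (nextValue ys g₁)) (toBlocks g₁ ys) (toBlocks-canonical g₁ b₁ ys a')
  states≡ : X.states ≡ Y.states
  states≡ = ≈c-canonical⇒≡ n X.states Y.states (trans X.length-states p) (trans Y.length-states p')
              X.states-path Y.states-path X.states-unique Y.states-unique X.states-canonical Y.states-canonical C≈C'

empty-partial : ∀ n → Partial n 0 []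
empty-partial n = tt , [] , refl

decode : ∀ n → Code (suc n) (suc n) 0 0 → Cycle (suc n)
decode n c = let a , p = build-admissible c [] (empty-partial (suc n)) refl in cycleOfMarked n (build c []) a p

decode-injective : ∀ n (c c' : Code (suc n) (suc n) 0 0) → decode n c ≈c decode n c' → c ≡ c'
decode-injective n c c' C≈C' =
  build-injective c c' [] (empty-partial (suc n)) (cycleOfMarked-injective n (build c []) (build c' []) _ _ _ _ C≈C')

≈c-≗ : ∀ {n} {C D D' : Cycle n} → (∀ k → v D' k ≡ v D k) → C ≈c D → C ≈c D'
≈c-≗ D'≗D (r , shift) = r , λ k → trans (D'≗D k) (shift k)

-- the code of a cycle: read its canonical rotation as blocks, then as a marked list
module Encode (n : ℕ) (C : Cycle (suc n)) where
  open Rotation n C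

  g₀ : ℕ
  g₀ = proj₁ rotated-head

  rest : List State
  rest = applyUpTo (λ k → rotated-at (suc k)) n

  rotated≡ : rotated ≡ ready g₀ ∷ rest
  rotated≡ = cong (_∷ rest) (proj₂ rotated-head)

  blocksOf : ∃₂ λ c bs → ready g₀ ∷ rest ≡ expand ((g₀ , c) ∷ bs) g₀ × Linked ((g₀ , c) ∷ bs) g₀
  blocksOf = path⇒blocks (length rest) g₀ rest g₀ ≤-refl
               (subst₂ Path rotated≡ (proj₂ rotated-head) rotated-path)

  blocks : Blocks
  blocks = (g₀ , proj₁ blocksOf) ∷ proj₁ (proj₂ blocksOf)

  linked : Linked blocks g₀
  linked = proj₂ (proj₂ (proj₂ blocksOf))

  rotated≡expand : rotated ≡ expand blocks g₀
  rotated≡expand = trans rotated≡ (proj₁ (proj₂ (proj₂ blocksOf)))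

  canonical : CanonicalBlocks blocks
  canonical = canonicalBlocks g₀ _ _ (subst Canonical rotated≡expand rotated-canonical)
                                     (subst Unique rotated≡expand rotated-unique) linked

  marked : Marked
  marked = fromBlocks blocks

  marked-admissible : Admissible marked
  marked-admissible = fromBlocks-admissible g₀ _ _ canonical

  marked-period : markedPeriod marked ≡ suc n
  marked-period = begin
    period (toBlocks g₀ marked)  ≡⟨ cong period (toBlocks-fromBlocks g₀ blocks linked) ⟩
    period blocks                ≡⟨ length-expand blocks g₀ linked ⟨
    length (expand blocks g₀)    ≡⟨ cong length rotated≡expand ⟨
    length rotated               ≡⟨ length-rotated ⟩
    suc n                        ∎
    where open ≡-Reasoning

  below-period : All (λ p → proj₁ p < suc n) marked
  below-period = g₀<N ∷ All-fromBlocks _ (All.map (λ g<g₀ → <-trans g<g₀ g₀<N) (proj₁ canonical))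
    where
    g₀<N : g₀ < suc n
    g₀<N = subst (g₀ <_) marked-period (head<markedPeriod g₀ _ _ marked-admissible)

  removeBelow-all : removeBelow (suc n) marked ≡ []
  removeBelow-all = All<∧All≥⇒[] _ (All-removeBelow marked (suc n) below-period)
                                   (proj₂ (removeBelow-admissible marked marked-admissible (suc n)))

  coded : ∃ λ (c : Code (suc n) (suc n) 0 0) → build c (removeBelow (suc n) marked) ≡ marked
  coded = build-surjective (suc n) (suc n) 0 0 marked marked-admissible
            (cong #high removeBelow-all) (cong markedPeriod removeBelow-all) marked-period

  code : Code (suc n) (suc n) 0 0
  code = proj₁ coded

  build-code : build code [] ≡ marked
  build-code = trans (cong (build code) (sym removeBelow-all)) (proj₂ coded)

  statesOf-marked : statesOf (build code []) ≡ rotated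
  statesOf-marked = begin
    statesOf (build code [])          ≡⟨ cong statesOf build-code ⟩
    expand (toBlocks g₀ marked) g₀    ≡⟨ cong (λ bs → expand bs g₀) (toBlocks-fromBlocks g₀ blocks linked) ⟩
    expand blocks g₀                  ≡⟨ rotated≡expand ⟨
    rotated                           ∎
    where open ≡-Reasoning

  ≈c-decode : C ≈c decode n code
  ≈c-decode = ≈c-≗ {suc n} {C} {cycleFrom n rotated length-rotated rotated-path rotated-unique} {decode n code}
    (λ k → trans (cycleOfMarked-v n (build code []) _ _ k) (cong (λ xs → at xs (k % suc n)) statesOf-marked))
    (≈c-rotated rotated-path rotated-unique)

-- Counting codes

when : ∀ {A : Set} → Dec A → ℕ → ℕ
when (yes _) x = x
when (no _) _ = 0

#Code : ℕ → ℕ → ℕ → ℕ → ℕ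
#Code n zero i σ = when (σ ≟ n) 1
#Code n (suc v) i σ = #Code n v i σ + i * #Code n v i σ + slots i * #Code n v (suc i) (suc v + σ)

Code-zero↔ : ∀ {n i σ} (d : Dec (σ ≡ n)) → Fin (when d 1) ↔ Code n 0 i σ
Code-zero↔ (yes refl) = mk↔ₛ′ (λ _ → end) (λ _ → zero) (λ { end → refl }) (λ { zero → refl })
Code-zero↔ (no σ≢n) = mk↔ₛ′ (λ ()) (λ { end → ⊥-elim (σ≢n refl) }) (λ { end → ⊥-elim (σ≢n refl) }) (λ ())

Code-suc↔ : ∀ {n v i σ} →
  ((Code n v i σ ⊎ (Fin i × Code n v i σ)) ⊎ (Fin (slots i) × Code n v (suc i) (suc v + σ))) ↔ Code n (suc v) i σ
Code-suc↔ {n} {v} {i} {σ} = mk↔ₛ′ to from (λ { (skip c) → refl ; (join e c) → refl ; (new e c) → refl })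
  (λ { (inj₁ (inj₁ c)) → refl ; (inj₁ (inj₂ (e , c))) → refl ; (inj₂ (e , c)) → refl })
  where
  Choices : Set
  Choices = (Code n v i σ ⊎ (Fin i × Code n v i σ)) ⊎ (Fin (slots i) × Code n v (suc i) (suc v + σ))
  to : Choices → Code n (suc v) i σ
  to (inj₁ (inj₁ c)) = skip c
  to (inj₁ (inj₂ (e , c))) = join e c
  to (inj₂ (e , c)) = new e c
  from : Code n (suc v) i σ → Choices
  from (skip c) = inj₁ (inj₁ c)
  from (join e c) = inj₁ (inj₂ (e , c))
  from (new e c) = inj₂ (e , c)

Fin-#Code↔Code : ∀ n v i σ → Fin (#Code n v i σ) ↔ Code n v i σ
Fin-#Code↔Code n zero i σ = Code-zero↔ (σ ≟ n)
Fin-#Code↔Code n (suc v) i σ =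
  ↔-trans +↔⊎ (↔-trans (↔-trans +↔⊎ (IH ⊎-↔ ↔-trans *↔× (↔-refl ×-↔ IH)) ⊎-↔ ↔-trans *↔× (↔-refl ×-↔ IH′))
                       Code-suc↔)
  where
  IH : Fin (#Code n v i σ) ↔ Code n v i σ
  IH = Fin-#Code↔Code n v i σ
  IH′ : Fin (#Code n v (suc i) (suc v + σ)) ↔ Code n v (suc i) (suc v + σ)
  IH′ = Fin-#Code↔Code n v (suc i) (suc v + σ)

-- The count as a sum over partitions into distinct parts

open import Data.Integer using (+_)

ι : ℕ → ℚ
ι a = + a / 1

fromℚᵘ-homo-+ : ∀ p q → fromℚᵘ p ℚ.+ fromℚᵘ q ≡ fromℚᵘ (p ℚᵘ.+ q)
fromℚᵘ-homo-+ p q = toℚᵘ-injective (ℚᵘₚ.≃-trans (toℚᵘ-homo-+ (fromℚᵘ p) (fromℚᵘ q))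
  (ℚᵘₚ.≃-trans (ℚᵘₚ.+-cong (toℚᵘ-fromℚᵘ p) (toℚᵘ-fromℚᵘ q)) (ℚᵘₚ.≃-sym (toℚᵘ-fromℚᵘ (p ℚᵘ.+ q)))))

fromℚᵘ-homo-* : ∀ p q → fromℚᵘ p ℚ.* fromℚᵘ q ≡ fromℚᵘ (p ℚᵘ.* q)
fromℚᵘ-homo-* p q = toℚᵘ-injective (ℚᵘₚ.≃-trans (toℚᵘ-homo-* (fromℚᵘ p) (fromℚᵘ q))
  (ℚᵘₚ.≃-trans (ℚᵘₚ.*-cong (toℚᵘ-fromℚᵘ p) (toℚᵘ-fromℚᵘ q)) (ℚᵘₚ.≃-sym (toℚᵘ-fromℚᵘ (p ℚᵘ.* q)))))

ι-+ : ∀ a b → ι (a + b) ≡ ι a ℚ.+ ι b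
ι-+ a b = sym (trans (fromℚᵘ-homo-+ (ℚᵘ.mkℚᵘ (+ a) 0) (ℚᵘ.mkℚᵘ (+ b) 0))
  (cong (λ z → fromℚᵘ (ℚᵘ.mkℚᵘ z 0)) (trans (cong₂ ℤ._+_ (ℤₚ.*-identityʳ (+ a)) (ℤₚ.*-identityʳ (+ b))) (sym (ℤₚ.pos-+ a b)))))

ι-* : ∀ a b → ι (a * b) ≡ ι a ℚ.* ι b
ι-* a b = sym (trans (fromℚᵘ-homo-* (ℚᵘ.mkℚᵘ (+ a) 0) (ℚᵘ.mkℚᵘ (+ b) 0))
  (cong (λ z → fromℚᵘ (ℚᵘ.mkℚᵘ z 0)) (sym (ℤₚ.pos-* a b))))

ι-^ : ∀ a k → ι (a ^ k) ≡ ι a ^ℚ k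
ι-^ a zero = refl
ι-^ a (suc k) = trans (ι-* a (a ^ k)) (cong (ι a ℚ.*_) (ι-^ a k))

/-*-cancel : ∀ a b → ((+ a) / suc b) ℚ.* ι (suc b) ≡ ι a
/-*-cancel a b = trans (fromℚᵘ-homo-* (ℚᵘ.mkℚᵘ (+ a) b) (ℚᵘ.mkℚᵘ (+ suc b) 0))
  (fromℚᵘ-cong {ℚᵘ.mkℚᵘ (+ a ℤ.* + suc b) (b * 1)} {ℚᵘ.mkℚᵘ (+ a) 0} (ℚᵘ.*≡* eq))
  where
  eq : (+ a ℤ.* + suc b) ℤ.* + 1 ≡ + a ℤ.* + suc (b * 1)
  eq = trans (ℤₚ.*-identityʳ _) (cong (λ z → + a ℤ.* + suc z) (sym (*-identityʳ b)))

^ℚ-distribʳ-* : ∀ x y k → (x ^ℚ k) ℚ.* (y ^ℚ k) ≡ (x ℚ.* y) ^ℚ k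
^ℚ-distribʳ-* x y zero = ℚₚ.*-identityˡ 1ℚ
^ℚ-distribʳ-* x y (suc k) =
  trans (solve 4 (λ x y a b → (x :* a) :* (y :* b) := (x :* y) :* (a :* b)) refl x y (x ^ℚ k) (y ^ℚ k))
        (cong ((x ℚ.* y) ℚ.*_) (^ℚ-distribʳ-* x y k))
  where open ℚ-Solver

Descending : ℕ → List ℕ → Set
Descending v [] = ⊤
Descending v (x ∷ q) = 1 ≤ x × x ≤ v × Descending (x ∸ 1) q

-- weight v i q counts the codes for v ∸ 1, …, 0, starting from i high entries,
-- whose new entries are exactly the values x ∸ 1 for x in q.
weight : ℕ → ℕ → List ℕ → ℕ
weight v i [] = suc i ^ v
weight v i (x ∷ q) = suc i ^ (v ∸ x) * (slots i * weight (x ∸ 1) (suc i) q)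

-- weight with every factor slots i replaced by i + 2: it clears the denominators of prodFrom
scaledWeight : ℕ → ℕ → List ℕ → ℕ
scaledWeight v i [] = suc i ^ v
scaledWeight v i (x ∷ q) = suc i ^ (v ∸ x) * (suc (suc i) * scaledWeight (x ∸ 1) (suc i) q)

prodFrom-scaled : ∀ v i q → Descending v q → prodFrom i q ℚ.* ι (suc i ^ v) ≡ ι (scaledWeight v i q)
prodFrom-scaled v i [] _ = ℚₚ.*-identityˡ _
prodFrom-scaled v i (suc x ∷ q) (_ , x<v , d) = begin
  (A ℚ.* P) ℚ.* ι (s ^ v)                   ≡⟨ cong ((A ℚ.* P) ℚ.*_) split ⟩
  (A ℚ.* P) ℚ.* (X ℚ.* Y)
    ≡⟨ solve 4 (λ A P X Y → (A :* P) :* (X :* Y) := (X :* (A :* Y)) :* P) refl A P X Y ⟩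
  (X ℚ.* (A ℚ.* Y)) ℚ.* P                   ≡⟨ cong (λ z → (X ℚ.* z) ℚ.* P) AY ⟩
  (X ℚ.* (ι s' ℚ.* ι (s' ^ x))) ℚ.* P
    ≡⟨ solve 4 (λ X S T P → (X :* (S :* T)) :* P := (X :* S) :* (P :* T)) refl X (ι s') (ι (s' ^ x)) P ⟩
  (X ℚ.* ι s') ℚ.* (P ℚ.* ι (s' ^ x))       ≡⟨ cong ((X ℚ.* ι s') ℚ.*_) (prodFrom-scaled x (suc i) q d) ⟩
  (X ℚ.* ι s') ℚ.* ι (scaledWeight x s q)   ≡⟨ ℚₚ.*-assoc X (ι s') _ ⟩
  X ℚ.* (ι s' ℚ.* ι (scaledWeight x s q))   ≡⟨ cong (X ℚ.*_) (ι-* s' (scaledWeight x s q)) ⟨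
  X ℚ.* ι (s' * scaledWeight x s q)         ≡⟨ ι-* (s ^ (v ∸ suc x)) _ ⟨
  ι (scaledWeight v i (suc x ∷ q))          ∎
  where
  open ≡-Reasoning
  open ℚ-Solver
  s s' : ℕ
  s = suc i
  s' = suc (suc i)
  A P X Y : ℚ
  A = ((+ s') / s) ^ℚ suc x
  P = prodFrom s q
  X = ι (s ^ (v ∸ suc x))
  Y = ι (s ^ suc x)
  split : ι (s ^ v) ≡ X ℚ.* Y
  split = trans (cong (λ z → ι (s ^ z)) (sym (m∸n+n≡m x<v)))
                (trans (cong ι (^-distribˡ-+-* s (v ∸ suc x) (suc x))) (ι-* (s ^ (v ∸ suc x)) (s ^ suc x)))
  AY : A ℚ.* Y ≡ ι s' ℚ.* ι (s' ^ x)
  AY = begin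
    A ℚ.* Y                             ≡⟨ cong (A ℚ.*_) (ι-^ s (suc x)) ⟩
    A ℚ.* (ι s ^ℚ suc x)                ≡⟨ ^ℚ-distribʳ-* ((+ s') / s) (ι s) (suc x) ⟩
    (((+ s') / s) ℚ.* ι s) ^ℚ suc x     ≡⟨ cong (_^ℚ suc x) (/-*-cancel s' i) ⟩
    ι s' ^ℚ suc x                       ≡⟨ ι-^ s' (suc x) ⟨
    ι (s' ^ suc x)                      ≡⟨ ι-* s' (s' ^ x) ⟩
    ι s' ℚ.* ι (s' ^ x)                 ∎

-- the factors i + 2 telescope against the missing t (t + 1)
scaledWeight-suc : ∀ v j q → Descending v q →
  suc j * suc (suc j) * scaledWeight v (suc j) q ≡ (suc j + length q) * suc (suc j + length q) * weight v (suc j) q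
scaledWeight-suc v j [] _ = cong (λ z → z * suc z * (suc (suc j) ^ v)) (sym (+-identityʳ (suc j)))
scaledWeight-suc v j (suc x ∷ q) (_ , _ , d) = begin
  i * suc i * (P * (suc (suc i) * E'))
    ≡⟨ solve 3 (λ i P E' → i :* (con 1 :+ i) :* (P :* ((con 2 :+ i) :* E'))
                         := P :* i :* ((con 1 :+ i) :* (con 2 :+ i) :* E')) refl i P E' ⟩
  P * i * (suc i * suc (suc i) * E')    ≡⟨ cong (P * i *_) (scaledWeight-suc x (suc j) q d) ⟩
  P * i * (m * suc m * W')
    ≡⟨ solve 4 (λ i P m W → P :* i :* (m :* (con 1 :+ m) :* W) := m :* (con 1 :+ m) :* (P :* (i :* W))) refl i P m W' ⟩
  m * suc m * (P * (i * W'))            ≡⟨ cong (λ z → z * suc z * (P * (i * W'))) (sym (+-suc (suc j) (length q))) ⟩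
  (i + suc (length q)) * suc (i + suc (length q)) * (P * (i * W')) ∎
  where
  open ≡-Reasoning
  open ℕ-Solver
  i P E' W' m : ℕ
  i = suc j
  P = suc i ^ (v ∸ suc x)
  E' = scaledWeight x (suc i) q
  W' = weight x (suc i) q
  m = suc i + length q

scaledWeight-zero : ∀ v x q → Descending v (x ∷ q) →
  scaledWeight v 0 (x ∷ q) ≡ length (x ∷ q) * suc (length (x ∷ q)) * weight v 0 (x ∷ q)
scaledWeight-zero v (suc x) q (_ , _ , d) = begin
  P * (2 * E')                                          ≡⟨ cong (P *_) (scaledWeight-suc x 0 q d) ⟩
  P * (suc (length q) * suc (suc (length q)) * W')
    ≡⟨ solve 3 (λ P t W → P :* ((con 1 :+ t) :* (con 2 :+ t) :* W)
                        := (con 1 :+ t) :* (con 2 :+ t) :* (P :* (con 1 :* W))) refl P (length q) W' ⟩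
  suc (length q) * suc (suc (length q)) * (P * (1 * W')) ∎
  where
  open ≡-Reasoning
  open ℕ-Solver
  P E' W' : ℕ
  P = 1 ^ (v ∸ suc x)
  E' = scaledWeight x 1 q
  W' = weight x 1 q

term≡weight : ∀ v x q → Descending v (x ∷ q) → term (x ∷ q) ≡ ι (weight v 0 (x ∷ q))
term≡weight v x q d = begin
  (+ 1 / k) ℚ.* prodFrom 0 (x ∷ q)                         ≡⟨ cong ((+ 1 / k) ℚ.*_) unscaled ⟩
  (+ 1 / k) ℚ.* ι (scaledWeight v 0 (x ∷ q))
    ≡⟨ cong (λ z → (+ 1 / k) ℚ.* ι z) (scaledWeight-zero v x q d) ⟩
  (+ 1 / k) ℚ.* ι (k * W)                                  ≡⟨ cong ((+ 1 / k) ℚ.*_) (ι-* k W) ⟩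
  (+ 1 / k) ℚ.* (ι k ℚ.* ι W)                              ≡⟨ ℚₚ.*-assoc (+ 1 / k) (ι k) _ ⟨
  ((+ 1 / k) ℚ.* ι k) ℚ.* ι W
    ≡⟨ cong (ℚ._* ι W) (/-*-cancel 1 (suc (length q + length q * suc (suc (length q))))) ⟩
  1ℚ ℚ.* ι W                                               ≡⟨ ℚₚ.*-identityˡ _ ⟩
  ι W                                                      ∎
  where
  open ≡-Reasoning
  k W : ℕ
  k = suc (length q) * suc (suc (length q))
  W = weight v 0 (x ∷ q)
  unscaled : prodFrom 0 (x ∷ q) ≡ ι (scaledWeight v 0 (x ∷ q))
  unscaled = trans (sym (ℚₚ.*-identityʳ _))
                   (trans (cong (λ z → prodFrom 0 (x ∷ q) ℚ.* ι z) (sym (^-zeroˡ v))) (prodFrom-scaled v 0 (x ∷ q) d))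

sumWeights : ℕ → ℕ → (List ℕ → ℕ) → List (List ℕ) → ℕ
sumWeights n σ f [] = 0
sumWeights n σ f (q ∷ L) = when (σ + sum q ≟ n) (f q) + sumWeights n σ f L

sumWeights-++ : ∀ n σ f L L′ → sumWeights n σ f (L ++ L′) ≡ sumWeights n σ f L + sumWeights n σ f L′
sumWeights-++ n σ f [] L′ = refl
sumWeights-++ n σ f (q ∷ L) L′ =
  trans (cong (_+_ (when (σ + sum q ≟ n) (f q))) (sumWeights-++ n σ f L L′))
        (sym (+-assoc (when (σ + sum q ≟ n) (f q)) (sumWeights n σ f L) (sumWeights n σ f L′)))

sumWeights-map-∷ : ∀ n σ f x L → sumWeights n σ f (map (x ∷_) L) ≡ sumWeights n (x + σ) (λ q → f (x ∷ q)) L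
sumWeights-map-∷ n σ f x [] = refl
sumWeights-map-∷ n σ f x (q ∷ L) =
  cong₂ _+_ (cong (λ m → when (m ≟ n) (f (x ∷ q))) (trans (sym (+-assoc σ x (sum q))) (cong (_+ sum q) (+-comm σ x))))
            (sumWeights-map-∷ n σ f x L)

when-* : ∀ {A : Set} (d : Dec A) k x → when d (k * x) ≡ k * when d x
when-* (yes _) k x = refl
when-* (no _) k x = sym (*-zeroʳ k)

sumWeights-scale : ∀ n σ k (f g : List ℕ → ℕ) L → All (λ q → f q ≡ k * g q) L → sumWeights n σ f L ≡ k * sumWeights n σ g L
sumWeights-scale n σ k f g [] [] = sym (*-zeroʳ k)
sumWeights-scale n σ k f g (q ∷ L) (f≡ ∷ fs≡) =
  trans (cong₂ _+_ (trans (cong (when (σ + sum q ≟ n)) f≡) (when-* (σ + sum q ≟ n) k (g q)))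
                   (sumWeights-scale n σ k f g L fs≡))
        (sym (*-distribˡ-+ k _ _))

Descending-mono : ∀ {v v'} q → v ≤ v' → Descending v q → Descending v' q
Descending-mono [] _ d = d
Descending-mono (x ∷ q) v≤v' (1≤x , x≤v , d) = 1≤x , ≤-trans x≤v v≤v' , d

sublists-descending : ∀ v → All (Descending v) (sublists (map suc (downFrom v)))
sublists-descending zero = tt ∷ []
sublists-descending (suc v) =
  ++⁺ (map⁺ (All.map (λ d → s≤s z≤n , ≤-refl , d) (sublists-descending v)))
      (All.map (λ {q} → Descending-mono q (n≤1+n v)) (sublists-descending v))

weight-suc : ∀ v i q → Descending v q → weight (suc v) i q ≡ suc i * weight v i q
weight-suc v i [] _ = refl
weight-suc v i (x ∷ q) (_ , x≤v , _) =
  trans (cong (λ z → suc i ^ z * (slots i * weight (x ∸ 1) (suc i) q)) (+-∸-assoc 1 x≤v)) (*-assoc (suc i) (suc i ^ (v ∸ x)) _)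

weight-head : ∀ v i q → weight (suc v) i (suc v ∷ q) ≡ slots i * weight v (suc i) q
weight-head v i q = trans (cong (λ z → suc i ^ z * (slots i * weight v (suc i) q)) (n∸n≡0 v)) (+-identityʳ _)

-- sorting the codes by their set of new entries
#Code≡sumWeights : ∀ n v i σ → #Code n v i σ ≡ sumWeights n σ (weight v i) (sublists (map suc (downFrom v)))
#Code≡sumWeights n zero i σ = trans (cong (λ m → when (m ≟ n) 1) (sym (+-identityʳ σ))) (sym (+-identityʳ _))
#Code≡sumWeights n (suc v) i σ = begin
  #Code n v i σ + i * #Code n v i σ + slots i * #Code n v (suc i) (suc v + σ)
    ≡⟨ +-comm (#Code n v i σ + i * #Code n v i σ) _ ⟩
  slots i * #Code n v (suc i) (suc v + σ) + suc i * #Code n v i σ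
    ≡⟨ cong₂ (λ a b → slots i * a + suc i * b) (#Code≡sumWeights n v (suc i) (suc v + σ)) (#Code≡sumWeights n v i σ) ⟩
  slots i * sumWeights n (suc v + σ) (weight v (suc i)) S + suc i * sumWeights n σ (weight v i) S
    ≡⟨ cong₂ _+_ (sumWeights-scale n (suc v + σ) (slots i) _ _ S (All.universal (weight-head v i) S))
                 (sumWeights-scale n σ (suc i) _ _ S (All.map (λ {q} → weight-suc v i q) (sublists-descending v))) ⟨
  sumWeights n (suc v + σ) (λ q → weight (suc v) i (suc v ∷ q)) S + sumWeights n σ (weight (suc v) i) S
    ≡⟨ cong (_+ sumWeights n σ (weight (suc v) i) S) (sumWeights-map-∷ n σ (weight (suc v) i) (suc v) S) ⟨
  sumWeights n σ (weight (suc v) i) (map (suc v ∷_) S) + sumWeights n σ (weight (suc v) i) S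
    ≡⟨ sumWeights-++ n σ (weight (suc v) i) (map (suc v ∷_) S) S ⟨
  sumWeights n σ (weight (suc v) i) (sublists (map suc (downFrom (suc v))))
    ∎
  where
  open ≡-Reasoning
  S : List (List ℕ)
  S = sublists (map suc (downFrom v))

RHS-sumWeights : ∀ n L → All (Descending (suc n)) L →
  sumℚ (map term (filter (λ p → sum p ≟ suc n) L)) ≡ ι (sumWeights (suc n) 0 (weight (suc n) 0) L)
RHS-sumWeights n [] [] = refl
RHS-sumWeights n (q ∷ L) (d ∷ ds) with sum q ≟ suc n
RHS-sumWeights n ([] ∷ L) (d ∷ ds) | yes ()
RHS-sumWeights n ((x ∷ q) ∷ L) (d ∷ ds) | yes sum≡ = begin
  sumℚ (map term (filter (λ p → sum p ≟ suc n) ((x ∷ q) ∷ L)))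
    ≡⟨ cong (sumℚ ∘ map term) (filter-accept (λ p → sum p ≟ suc n) {x ∷ q} {L} sum≡) ⟩
  term (x ∷ q) ℚ.+ sumℚ (map term (filter (λ p → sum p ≟ suc n) L))
    ≡⟨ cong₂ ℚ._+_ (term≡weight (suc n) x q d) (RHS-sumWeights n L ds) ⟩
  ι W ℚ.+ ι Ws
    ≡⟨ ι-+ W Ws ⟨
  ι (W + Ws) ∎
  where
  open ≡-Reasoning
  W Ws : ℕ
  W = weight (suc n) 0 (x ∷ q)
  Ws = sumWeights (suc n) 0 (weight (suc n) 0) L
RHS-sumWeights n (q ∷ L) (d ∷ ds) | no sum≢ =
  trans (cong (sumℚ ∘ map term) (filter-reject (λ p → sum p ≟ suc n) {q} {L} sum≢)) (RHS-sumWeights n L ds)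

#Code≡RHS : ∀ n → ι (#Code (suc n) (suc n) 0 0) ≡ RHS (suc n)
#Code≡RHS n = begin
  ι (#Code (suc n) (suc n) 0 0)
    ≡⟨ cong ι (#Code≡sumWeights (suc n) (suc n) 0 0) ⟩
  ι (sumWeights (suc n) 0 (weight (suc n) 0) (sublists (map suc (downFrom (suc n)))))
    ≡⟨ RHS-sumWeights n _ (sublists-descending (suc n)) ⟨
  RHS (suc n) ∎
  where open ≡-Reasoning

theorem2p5 : ∀ (n : ℕ) → 1 Data.Nat.≤ n →
    ∃[ m ] (HasCycleCount n m × ((+ m) / 1 ≡ RHS n))
theorem2p5 (suc n) _ = #Code N N 0 0 , (rep , rep-injective , rep-surjective) , #Code≡RHS n
  where
  N : ℕ
  N = suc n
  open Inverse (Fin-#Code↔Code N N 0 0)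
  rep : Fin (#Code N N 0 0) → Cycle N
  rep a = decode n (to a)
  rep-injective : ∀ a b → rep a ≈c rep b → a ≡ b
  rep-injective a b ra≈rb = trans (sym (strictlyInverseʳ a))
                                  (trans (cong from (decode-injective n (to a) (to b) ra≈rb)) (strictlyInverseʳ b))
  rep-surjective : ∀ C → ∃[ a ] (C ≈c rep a)
  rep-surjective C = from code , subst (λ c → C ≈c decode n c) (sym (strictlyInverseˡ code)) ≈c-decode
    where open Encode n C
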